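{- For all integers $r \geq s \geq 0$ there exist positive constants $\varepsilon = \varepsilon(r,s)$, $\alpha = \alpha(r,s)$ and $n_1 = n_1(r,s)$ such that the following holds. Let $n \geq n_1$ and let $F \subseteq \binom{[n]}{r}$ be a family of at most $\varepsilon n \binom{n-s}{r-s}$ $r$-sets such that every $s$-set $S \in \binom{[n]}{s}$ is contained in fewer than $\alpha \binom{n-s}{r-s}$ members of $F$. Then $\mathrm{rk}\, M_s^r(K_n^r - F) = \binom{n}{s}$.
   Context: $K_n^r$ is the complete $r$-graph on vertex set $[n]$ (all $r$-subsets of $[n]$ as edges), and $K_n^r - F$ is the $r$-graph on $[n]$ with edge set $\binom{[n]}{r} \setminus F$. For an $r$-graph $G$ and $0 \le s \le r$, the higher inclusion matrix $M_s^r(G)$ is the $\{0,1\}$-matrix with rows indexed by the edges of $G$ and columns indexed by the $s$-subsets of $V(G)$, the entry for edge $e$ and $s$-set $S$ being $1$ if $S \subseteq e$ and $0$ otherwise; $\mathrm{rk}$ denotes rank over the reals. -}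

module Defs where

open import Data.Nat using (ℕ; zero; suc; _≤_)
open import Data.Nat.Combinatorics using (_C_)
open import Data.Bool using (Bool; true; false)
import Data.Bool.Properties as BoolP
open import Data.Fin.Subset using (Subset; ∣_∣; _⊆_)
open import Data.Fin.Subset.Properties using (_⊆?_)
open import Data.Vec using (Vec; []; _∷_)
open import Data.Vec.Properties using (≡-dec)
open import Data.List using (List; []; _∷_; _++_; map; filter; length; foldr)
open import Data.List.Relation.Unary.All using (All)
open import Data.List.Relation.Unary.Unique.Propositional using (Unique)
open import Data.Rational using (ℚ; 0ℚ; _+_; _*_; _/_)
open import Data.Integer using (+_)
open import Data.Product using (Σ; _×_; ∃)
open import Relation.Nullary using (¬_; Dec; yes; no; ¬?)
open import Relation.Binary.PropositionalEquality using (_≡_)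
open import Relation.Binary.Definitions using (DecidableEquality)
import Data.List.Membership.DecPropositional as DecMem
open import Data.List.Membership.Propositional using (_∈_)
open import Data.Nat.Properties using (_≟_)

_≟ˢ_ : {n : ℕ} → DecidableEquality (Subset n)
_≟ˢ_ = ≡-dec BoolP._≟_

_∈ˢ?_ : {n : ℕ} (x : Subset n) (xs : List (Subset n)) → Dec (x ∈ xs)
_∈ˢ?_ {n} = DecMem._∈?_ (_≟ˢ_ {n})

ℕtoℚ : ℕ → ℚ
ℕtoℚ k = + k / 1

allSubsets : (n : ℕ) → List (Subset n)
allSubsets zero = [] ∷ []
allSubsets (suc n) = map (true ∷_) (allSubsets n) ++ map (false ∷_) (allSubsets n)

kSets : (n k : ℕ) → List (Subset n)
kSets n k = filter (λ p → ∣ p ∣ ≟ k) (allSubsets n)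

sumℚ : List ℚ → ℚ
sumℚ = foldr _+_ 0ℚ

ColumnsIndependent : {R C : Set} → List R → List C → (R → C → ℚ) → Set
ColumnsIndependent {R} {C} rows cols M =
  (c : C → ℚ) →
  (∀ e → e ∈ rows → sumℚ (map (λ S → c S * M e S) cols) ≡ 0ℚ) →
  ∀ S → S ∈ cols → c S ≡ 0ℚ

HasRank : {R C : Set} → List R → List C → (R → C → ℚ) → ℕ → Set
HasRank {R} {C} rows cols M k =
  (Σ (List C) λ sub → Unique sub × All (_∈ cols) sub × length sub ≡ k
       × ColumnsIndependent rows sub M)
  × (∀ (sub : List C) → Unique sub → All (_∈ cols) sub →
       ColumnsIndependent rows sub M → length sub ≤ k)

edgesMinus : (n r : ℕ) → List (Subset n) → List (Subset n)
edgesMinus n r F = filter (λ e → ¬? (e ∈ˢ? F)) (kSets n r)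

inclEntry : {n : ℕ} → Subset n → Subset n → ℚ
inclEntry e S with S ⊆? e
... | yes _ = ℕtoℚ 1
... | no _ = 0ℚ

-- rk M_s^r(G) = k, for G = K_n^r - F (rows: edges of G, columns: s-subsets of [n])
RankInclusionMinus : (n r s : ℕ) → List (Subset n) → ℕ → Set
RankInclusionMinus n r s F k = HasRank (edgesMinus n r F) (kSets n s) inclEntry k

degree : {n : ℕ} → List (Subset n) → Subset n → ℕ
degree F S = length (filter (λ e → S ⊆? e) F)

module Submission where

-- Take ε = 1, α = 1/(4^s + 1) and n₁ = 2r + 1.  Rank C(n,s) means the s-set columns are independent: if
-- Σ_{S ⊆ e} c(S) = 0 for every edge e, then c = 0.  By induction on s
-- (Vanishing): subtracting the equations of T ∪ {u} and T ∪ {v} shows that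
-- c(S ∪ {u}) - c(S ∪ {v}) satisfies the same kind of system one level lower
-- on [n] - {u, v}, hence vanishes; so c is constant on s-sets (Exchange)
-- and one edge forces the constant to be 0.  The recursion needs edges that
-- avoid F at every level, which exist because the degrees are small
-- (Blocking, Construction, DegreeSums).  Independence of all C(n,s)
-- columns then gives the rank (Rank), and the rank is at most C(n,s) by
-- pigeonhole.


-- The only rationals the argument
-- handles are natural numbers and the reciprocals 1/(k+1) used as the
-- constant α; all facts are transported through the unnormalised rationals.
module NaturalRationals where
  open import Defs using (ℕtoℚ)
  open import Data.Nat as ℕ using (ℕ; suc)
  import Data.Nat.Properties as ℕ
  open import Data.Integer as ℤ using (+_)
  import Data.Integer.Properties as ℤ
  open import Data.Nat.Coprimality using (1-coprimeTo) renaming (sym to coprime-sym)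
  open import Data.Rational using (ℚ; 0ℚ; 1ℚ; mkℚ; toℚᵘ; _+_; _*_; _<_; *<*; Positive)
  open import Data.Rational.Properties
    using (normalize-coprime; toℚᵘ-injective; toℚᵘ-homo-+; toℚᵘ-homo-*;
           *-assoc; *-comm; *-identityˡ; *-zeroʳ; *-monoʳ-<-pos)
  import Data.Rational.Unnormalised as ℚᵘ
  import Data.Rational.Unnormalised.Properties as ℚᵘ
  open import Relation.Binary.PropositionalEquality
  open ≡-Reasoning

  ℕtoℚ-mkℚ : ∀ k → ℕtoℚ k ≡ mkℚ (+ k) 0 (coprime-sym (1-coprimeTo k))
  ℕtoℚ-mkℚ k = normalize-coprime _

  toℚᵘ-ℕtoℚ : ∀ k → toℚᵘ (ℕtoℚ k) ≡ ℚᵘ.mkℚᵘ (+ k) 0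
  toℚᵘ-ℕtoℚ k = cong toℚᵘ (ℕtoℚ-mkℚ k)

  ℕtoℚ-+ : ∀ a b → ℕtoℚ (a ℕ.+ b) ≡ ℕtoℚ a + ℕtoℚ b
  ℕtoℚ-+ a b = toℚᵘ-injective (ℚᵘ.≃-trans lhs (ℚᵘ.≃-sym (toℚᵘ-homo-+ (ℕtoℚ a) (ℕtoℚ b))))
    where
    lhs : toℚᵘ (ℕtoℚ (a ℕ.+ b)) ℚᵘ.≃ (toℚᵘ (ℕtoℚ a) ℚᵘ.+ toℚᵘ (ℕtoℚ b))
    lhs rewrite toℚᵘ-ℕtoℚ (a ℕ.+ b) | toℚᵘ-ℕtoℚ a | toℚᵘ-ℕtoℚ b = ℚᵘ.*≡* (begin
      + (a ℕ.+ b) ℤ.* + 1             ≡⟨ ℤ.*-identityʳ _ ⟩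
      + (a ℕ.+ b)                     ≡⟨ ℤ.pos-+ a b ⟩
      + a ℤ.+ + b                     ≡⟨ cong₂ ℤ._+_ (sym (ℤ.*-identityʳ (+ a))) (sym (ℤ.*-identityʳ (+ b))) ⟩
      + a ℤ.* + 1 ℤ.+ + b ℤ.* + 1     ≡⟨ sym (ℤ.*-identityʳ _) ⟩
      (+ a ℤ.* + 1 ℤ.+ + b ℤ.* + 1) ℤ.* + 1 ∎)

  ℕtoℚ-* : ∀ a b → ℕtoℚ (a ℕ.* b) ≡ ℕtoℚ a * ℕtoℚ b
  ℕtoℚ-* a b = toℚᵘ-injective (ℚᵘ.≃-trans lhs (ℚᵘ.≃-sym (toℚᵘ-homo-* (ℕtoℚ a) (ℕtoℚ b))))
    where
    lhs : toℚᵘ (ℕtoℚ (a ℕ.* b)) ℚᵘ.≃ (toℚᵘ (ℕtoℚ a) ℚᵘ.* toℚᵘ (ℕtoℚ b))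
    lhs rewrite toℚᵘ-ℕtoℚ (a ℕ.* b) | toℚᵘ-ℕtoℚ a | toℚᵘ-ℕtoℚ b = ℚᵘ.*≡* (begin
      + (a ℕ.* b) ℤ.* + 1   ≡⟨ ℤ.*-identityʳ _ ⟩
      + (a ℕ.* b)           ≡⟨ ℤ.pos-* a b ⟩
      + a ℤ.* + b           ≡⟨ sym (ℤ.*-identityʳ _) ⟩
      (+ a ℤ.* + b) ℤ.* + 1 ∎)

  ℕtoℚ-<⁻¹ : ∀ {a b} → ℕtoℚ a < ℕtoℚ b → a ℕ.< b
  ℕtoℚ-<⁻¹ {a} {b} p rewrite ℕtoℚ-mkℚ a | ℕtoℚ-mkℚ b with p
  ... | *<* q rewrite ℤ.*-identityʳ (+ a) | ℤ.*-identityʳ (+ b) = ℤ.drop‿+<+ q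

  ℕtoℚ-suc-positive : ∀ k → Positive (ℕtoℚ (suc k))
  ℕtoℚ-suc-positive k = subst Positive (sym (ℕtoℚ-mkℚ (suc k))) _

  1/suc : ℕ → ℚ
  1/suc k = mkℚ (+ 1) k (1-coprimeTo (suc k))

  1/suc-positive : ∀ k → 0ℚ < 1/suc k
  1/suc-positive k = *<* (ℤ.+<+ (ℕ.s≤s ℕ.z≤n))

  1/suc-inverse : ∀ k → ℕtoℚ (suc k) * 1/suc k ≡ 1ℚ
  1/suc-inverse k = toℚᵘ-injective (ℚᵘ.≃-trans (toℚᵘ-homo-* (ℕtoℚ (suc k)) (1/suc k)) lhs)
    where
    lhs : (toℚᵘ (ℕtoℚ (suc k)) ℚᵘ.* toℚᵘ (1/suc k)) ℚᵘ.≃ toℚᵘ 1ℚ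
    lhs rewrite toℚᵘ-ℕtoℚ (suc k) = ℚᵘ.*≡* (cong (λ x → + suc x) denominators)
      where
      denominators : k ℕ.* 1 ℕ.* 1 ≡ k ℕ.+ 0 ℕ.* suc k ℕ.+ 0 ℕ.* suc (k ℕ.+ 0 ℕ.* suc k)
      denominators = trans (ℕ.*-identityʳ (k ℕ.* 1))
        (trans (ℕ.*-identityʳ k) (sym (trans (ℕ.+-identityʳ _) (ℕ.+-identityʳ k))))

  suc-*-cancel : ∀ k a → ℕtoℚ (suc k) * a ≡ 0ℚ → a ≡ 0ℚ
  suc-*-cancel k a h = begin
    a                              ≡⟨ sym (*-identityˡ a) ⟩
    1ℚ * a                         ≡⟨ cong (_* a) (sym (trans (*-comm (1/suc k) (ℕtoℚ (suc k))) (1/suc-inverse k))) ⟩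
    (1/suc k * ℕtoℚ (suc k)) * a   ≡⟨ *-assoc (1/suc k) (ℕtoℚ (suc k)) a ⟩
    1/suc k * (ℕtoℚ (suc k) * a)   ≡⟨ cong (1/suc k *_) h ⟩
    1/suc k * 0ℚ                   ≡⟨ *-zeroʳ (1/suc k) ⟩
    0ℚ                             ∎

  below-fraction : ∀ k d c → ℕtoℚ d < 1/suc k * ℕtoℚ c → suc k ℕ.* d ℕ.< c
  below-fraction k d c h = ℕtoℚ-<⁻¹ (subst₂ _<_ (sym (ℕtoℚ-* (suc k) d)) cleared
      (*-monoʳ-<-pos (ℕtoℚ (suc k)) {{ℕtoℚ-suc-positive k}} h))
    where
    cleared : ℕtoℚ (suc k) * (1/suc k * ℕtoℚ c) ≡ ℕtoℚ c
    cleared = trans (sym (*-assoc (ℕtoℚ (suc k)) (1/suc k) (ℕtoℚ c)))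
      (trans (cong (_* ℕtoℚ c) (1/suc-inverse k)) (*-identityˡ _))


module Binomials where
  open import Data.Nat as ℕ using (ℕ; zero; suc; _≤_; _^_; _*_; _+_)
  import Data.Nat.Properties as ℕ
  open import Data.Nat.Combinatorics using (_C_; nCk+nC[k+1]≡[n+1]C[k+1]; nC1≡n)
  open import Data.Nat.Solver using (module +-*-Solver)
  open +-*-Solver
  open import Data.Product using (Σ-syntax; _,_)
  open import Relation.Binary.PropositionalEquality

  -- For k ≤ n, C(n, k) is a successor (so it can be cancelled in ℚ).
  C-positive : ∀ {n k} → k ≤ n → Σ[ j ∈ ℕ ] n C k ≡ suc j
  C-positive {k = zero} h = 0 , refl
  C-positive {suc n} {suc k} (ℕ.s≤s h) with C-positive h
  ... | j , e = j + n C suc k ,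
    trans (sym (nCk+nC[k+1]≡[n+1]C[k+1] n k)) (cong (_+ n C suc k) e)

  absorption : ∀ p k → suc k * (p C suc k) + k * (p C k) ≡ p * (p C k)
  absorption zero zero = refl
  absorption zero (suc k) = cong₂ _+_ (ℕ.*-zeroʳ (suc (suc k))) (ℕ.*-zeroʳ (suc k))
  absorption (suc p) zero =
    trans (ℕ.+-identityʳ _) (trans (ℕ.*-identityˡ _) (trans (nC1≡n (suc p)) (sym (ℕ.*-identityʳ (suc p)))))
  absorption (suc p) (suc j) = begin
    suc (suc j) * (suc p C suc (suc j)) + suc j * (suc p C suc j)
      ≡⟨ cong₂ (λ x y → suc (suc j) * x + suc j * y)
               (sym (nCk+nC[k+1]≡[n+1]C[k+1] p (suc j))) (sym (nCk+nC[k+1]≡[n+1]C[k+1] p j)) ⟩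
    suc (suc j) * (b + c) + suc j * (a + b)
      ≡⟨ solve 4 (λ j a b c → (con 2 :+ j) :* (b :+ c) :+ (con 1 :+ j) :* (a :+ b)
                := ((con 2 :+ j) :* c :+ (con 1 :+ j) :* b) :+ ((con 1 :+ j) :* b :+ j :* a) :+ b :+ a)
               refl j a b c ⟩
    (suc (suc j) * c + suc j * b) + (suc j * b + j * a) + b + a
      ≡⟨ cong₂ (λ x y → x + y + b + a) (absorption p (suc j)) (absorption p j) ⟩
    p * b + p * a + b + a
      ≡⟨ solve 3 (λ p a b → p :* b :+ p :* a :+ b :+ a := (con 1 :+ p) :* (a :+ b)) refl p a b ⟩
    suc p * (a + b)
      ≡⟨ cong (suc p *_) (nCk+nC[k+1]≡[n+1]C[k+1] p j) ⟩
    suc p * (suc p C suc j) ∎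
    where
    open ≡-Reasoning
    a = p C j
    b = p C suc j
    c = p C suc (suc j)

  C-increasing : ∀ p t → 2 * suc t ≤ p → p C t ≤ p C suc t
  C-increasing p t h = ℕ.*-cancelˡ-≤ (suc t) (ℕ.+-cancelʳ-≤ (t * (p C t)) _ _ (begin
    suc t * (p C t) + t * (p C t)
      ≡⟨ solve 2 (λ t x → (con 1 :+ t) :* x :+ t :* x := (con 1 :+ (t :+ t)) :* x) refl t (p C t) ⟩
    suc (t + t) * (p C t)
      ≤⟨ ℕ.*-monoˡ-≤ (p C t) (ℕ.≤-trans (ℕ.n≤1+n _) (subst (_≤ p) 2[t+1]≡t+t+2 h)) ⟩
    p * (p C t)
      ≡⟨ sym (absorption p t) ⟩
    suc t * (p C suc t) + t * (p C t) ∎))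
    where
    open ℕ.≤-Reasoning
    2[t+1]≡t+t+2 : 2 * suc t ≡ suc (suc (t + t))
    2[t+1]≡t+t+2 = solve 1 (λ t → con 2 :* (con 1 :+ t) := con 1 :+ (con 1 :+ (t :+ t))) refl t

  C-suc-≤ : ∀ p t → 2 * t ≤ p → suc p C t ≤ 2 * (p C t)
  C-suc-≤ p zero h = ℕ.s≤s ℕ.z≤n
  C-suc-≤ p (suc t) h = begin
    suc p C suc t          ≡⟨ sym (nCk+nC[k+1]≡[n+1]C[k+1] p t) ⟩
    p C t + p C suc t      ≤⟨ ℕ.+-monoˡ-≤ (p C suc t) (C-increasing p t h) ⟩
    p C suc t + p C suc t  ≡⟨ solve 1 (λ x → x :+ x := con 2 :* x) refl (p C suc t) ⟩
    2 * (p C suc t)        ∎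
    where open ℕ.≤-Reasoning

  C-+-≤ : ∀ j p t → 2 * t ≤ p → (j + p) C t ≤ 2 ^ j * (p C t)
  C-+-≤ zero p t h = ℕ.≤-reflexive (sym (ℕ.+-identityʳ _))
  C-+-≤ (suc j) p t h = begin
    suc (j + p) C t       ≤⟨ C-suc-≤ (j + p) t (ℕ.≤-trans h (ℕ.m≤n+m p j)) ⟩
    2 * ((j + p) C t)     ≤⟨ ℕ.*-monoʳ-≤ 2 (C-+-≤ j p t h) ⟩
    2 * (2 ^ j * (p C t)) ≡⟨ sym (ℕ.*-assoc 2 (2 ^ j) (p C t)) ⟩
    2 ^ suc j * (p C t)   ∎
    where open ℕ.≤-Reasoning


-- All the combinatorics below is
-- by recursion on these vectors, so besides the library's membership '_∈_'
-- we use an inductive inclusion relation '_⊑_' and the single-element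
-- updates 'insert' and 'remove', which compute on the head of the vector.
module Subsets where
  open import Data.Nat as ℕ using (ℕ; zero; suc)
  import Data.Nat.Properties as ℕ
  open import Data.Bool using (true; false)
  open import Data.Fin using (Fin; zero; suc)
  open import Data.Vec using ([]; _∷_; here; there; _[_]≔_)
  open import Data.Fin.Subset using (Subset; ∣_∣; _∈_; _∉_; ⊥; ⊤)
  open import Data.Empty using (⊥-elim)
  open import Data.Product using (Σ-syntax; _×_; _,_)
  open import Relation.Binary.PropositionalEquality

  infix 4 _⊑_
  data _⊑_ : {n : ℕ} → Subset n → Subset n → Set where
    []⊑  : [] ⊑ []
    out⊑ : ∀ {n} {p q : Subset n} {b} → p ⊑ q → (false ∷ p) ⊑ (b ∷ q)
    in⊑  : ∀ {n} {p q : Subset n} → p ⊑ q → (true ∷ p) ⊑ (true ∷ q)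

  insert remove : ∀ {n} → Subset n → Fin n → Subset n
  insert p u = p [ u ]≔ true
  remove p u = p [ u ]≔ false

  ⊑-refl : ∀ {n} (p : Subset n) → p ⊑ p
  ⊑-refl [] = []⊑
  ⊑-refl (false ∷ p) = out⊑ (⊑-refl p)
  ⊑-refl (true ∷ p) = in⊑ (⊑-refl p)

  ⊑-trans : ∀ {n} {p q r : Subset n} → p ⊑ q → q ⊑ r → p ⊑ r
  ⊑-trans []⊑ []⊑ = []⊑
  ⊑-trans (out⊑ a) (out⊑ b) = out⊑ (⊑-trans a b)
  ⊑-trans (out⊑ a) (in⊑ b) = out⊑ (⊑-trans a b)
  ⊑-trans (in⊑ a) (in⊑ b) = in⊑ (⊑-trans a b)

  ⊥-⊑ : ∀ {n} (p : Subset n) → ⊥ ⊑ p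
  ⊥-⊑ [] = []⊑
  ⊥-⊑ (b ∷ p) = out⊑ (⊥-⊑ p)

  ⊑-⊤ : ∀ {n} (p : Subset n) → p ⊑ ⊤
  ⊑-⊤ [] = []⊑
  ⊑-⊤ (false ∷ p) = out⊑ (⊑-⊤ p)
  ⊑-⊤ (true ∷ p) = in⊑ (⊑-⊤ p)

  ∈-⊑ : ∀ {n} {u : Fin n} {p q} → u ∈ p → p ⊑ q → u ∈ q
  ∈-⊑ here (in⊑ s) = here
  ∈-⊑ (there m) (out⊑ s) = there (∈-⊑ m s)
  ∈-⊑ (there m) (in⊑ s) = there (∈-⊑ m s)

  ⊑-∣∣ : ∀ {n} {p q : Subset n} → p ⊑ q → ∣ p ∣ ℕ.≤ ∣ q ∣
  ⊑-∣∣ []⊑ = ℕ.z≤n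
  ⊑-∣∣ {q = false ∷ q} (out⊑ s) = ⊑-∣∣ s
  ⊑-∣∣ {q = true ∷ q} (out⊑ s) = ℕ.m≤n⇒m≤1+n (⊑-∣∣ s)
  ⊑-∣∣ (in⊑ s) = ℕ.s≤s (⊑-∣∣ s)

  ⊑-∣∣-≡ : ∀ {n} {p q : Subset n} → p ⊑ q → ∣ p ∣ ≡ ∣ q ∣ → p ≡ q
  ⊑-∣∣-≡ []⊑ e = refl
  ⊑-∣∣-≡ {q = false ∷ q} (out⊑ s) e = cong (false ∷_) (⊑-∣∣-≡ s e)
  ⊑-∣∣-≡ {q = true ∷ q} (out⊑ s) e = ⊥-elim (ℕ.<-irrefl e (ℕ.s≤s (⊑-∣∣ s)))
  ⊑-∣∣-≡ (in⊑ s) e = cong (true ∷_) (⊑-∣∣-≡ s (ℕ.suc-injective e))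

  ∣insert∣ : ∀ {n} (p : Subset n) {u} → u ∉ p → ∣ insert p u ∣ ≡ suc ∣ p ∣
  ∣insert∣ (true ∷ p) {zero} h = ⊥-elim (h here)
  ∣insert∣ (false ∷ p) {zero} h = refl
  ∣insert∣ (false ∷ p) {suc u} h = ∣insert∣ p (λ m → h (there m))
  ∣insert∣ (true ∷ p) {suc u} h = cong suc (∣insert∣ p (λ m → h (there m)))

  ∣remove∣ : ∀ {n} (p : Subset n) {u} → u ∈ p → suc ∣ remove p u ∣ ≡ ∣ p ∣
  ∣remove∣ (true ∷ p) here = refl
  ∣remove∣ (false ∷ p) (there m) = ∣remove∣ p m
  ∣remove∣ (true ∷ p) (there m) = cong suc (∣remove∣ p m)

  insert-⊑ : ∀ {n} {T V : Subset n} {u} → u ∈ V → T ⊑ V → insert T u ⊑ V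
  insert-⊑ here (out⊑ s) = in⊑ s
  insert-⊑ here (in⊑ s) = in⊑ s
  insert-⊑ (there m) (out⊑ s) = out⊑ (insert-⊑ m s)
  insert-⊑ (there m) (in⊑ s) = in⊑ (insert-⊑ m s)

  remove-⊑ : ∀ {n} (p : Subset n) u → remove p u ⊑ p
  remove-⊑ (b ∷ p) zero = out⊑ (⊑-refl p)
  remove-⊑ (false ∷ p) (suc u) = out⊑ (remove-⊑ p u)
  remove-⊑ (true ∷ p) (suc u) = in⊑ (remove-⊑ p u)

  ∉-remove : ∀ {n} (p : Subset n) u → u ∉ remove p u
  ∉-remove (b ∷ p) (suc u) (there m) = ∉-remove p u m

  ∈-remove : ∀ {n} {p : Subset n} {v} u → v ∈ p → v ≢ u → v ∈ remove p u
  ∈-remove zero here h = ⊥-elim (h refl)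
  ∈-remove zero (there m) h = there m
  ∈-remove (suc u) here h = here
  ∈-remove (suc u) (there m) h = there (∈-remove u m (λ e → h (cong suc e)))

  ⊑-remove⁻ : ∀ {n} {T V : Subset n} u → T ⊑ remove V u → T ⊑ V × u ∉ T
  ⊑-remove⁻ {V = b ∷ V} zero (out⊑ s) = out⊑ s , λ ()
  ⊑-remove⁻ {V = b ∷ V} (suc u) (out⊑ s) with ⊑-remove⁻ u s
  ... | s′ , u∉ = out⊑ s′ , λ { (there m) → u∉ m }
  ⊑-remove⁻ {V = b ∷ V} (suc u) (in⊑ s) with ⊑-remove⁻ u s
  ... | s′ , u∉ = in⊑ s′ , λ { (there m) → u∉ m }

  ⊑-remove⁺ : ∀ {n} {T V : Subset n} u → T ⊑ V → u ∉ T → T ⊑ remove V u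
  ⊑-remove⁺ zero (out⊑ s) h = out⊑ s
  ⊑-remove⁺ zero (in⊑ s) h = ⊥-elim (h here)
  ⊑-remove⁺ (suc u) (out⊑ s) h = out⊑ (⊑-remove⁺ u s (λ m → h (there m)))
  ⊑-remove⁺ (suc u) (in⊑ s) h = in⊑ (⊑-remove⁺ u s (λ m → h (there m)))

  insert-remove : ∀ {n} {p : Subset n} {u} → u ∈ p → insert (remove p u) u ≡ p
  insert-remove here = refl
  insert-remove {p = b ∷ p} (there m) = cong (b ∷_) (insert-remove m)

  ∣p∣≡0⇒p≡⊥ : ∀ {n} (p : Subset n) → ∣ p ∣ ≡ 0 → p ≡ ⊥
  ∣p∣≡0⇒p≡⊥ [] e = refl
  ∣p∣≡0⇒p≡⊥ (false ∷ p) e = cong (false ∷_) (∣p∣≡0⇒p≡⊥ p e)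

  nonempty : ∀ {n} (p : Subset n) → 1 ℕ.≤ ∣ p ∣ → Σ[ u ∈ Fin n ] u ∈ p
  nonempty (true ∷ p) h = zero , here
  nonempty (false ∷ p) h with nonempty p h
  ... | u , m = suc u , there m

  two-elements : ∀ {n} (p : Subset n) → 2 ℕ.≤ ∣ p ∣ →
                 Σ[ u ∈ Fin n ] Σ[ v ∈ Fin n ] u ∈ p × v ∈ p × u ≢ v
  two-elements p h with nonempty p (ℕ.≤-trans (ℕ.s≤s ℕ.z≤n) h)
  ... | u , u∈p with nonempty (remove p u) (ℕ.≤-pred (subst (2 ℕ.≤_) (sym (∣remove∣ p u∈p)) h))
  ... | v , v∈p-u = u , v , u∈p , ∈-⊑ v∈p-u (remove-⊑ p u) ,
                    λ { refl → ∉-remove p u v∈p-u }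


-- Induction on |A ─ B|: swap an
-- element of A ─ B for one of B ─ A, which lowers the distance by one.
module Exchange where
  open Subsets
  open import Data.Nat as ℕ using (ℕ; zero; suc; _+_)
  import Data.Nat.Properties as ℕ
  open import Data.Bool using (true; false)
  open import Data.Fin using (Fin)
  open import Data.Vec using ([]; _∷_; here; there)
  open import Data.Fin.Subset using (Subset; ∣_∣; _∈_; _∉_; _∩_; _─_)
  open import Data.Fin.Subset.Properties using (∩-comm)
  open import Data.Product using (Σ-syntax; _×_; _,_)
  open import Data.Empty using (⊥-elim)
  open import Relation.Binary.PropositionalEquality

  ∣p∣≡∣p∩q∣+∣p─q∣ : ∀ {n} (p q : Subset n) → ∣ p ∣ ≡ ∣ p ∩ q ∣ + ∣ p ─ q ∣
  ∣p∣≡∣p∩q∣+∣p─q∣ [] [] = refl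
  ∣p∣≡∣p∩q∣+∣p─q∣ (true ∷ p) (true ∷ q) = cong suc (∣p∣≡∣p∩q∣+∣p─q∣ p q)
  ∣p∣≡∣p∩q∣+∣p─q∣ (true ∷ p) (false ∷ q) =
    trans (cong suc (∣p∣≡∣p∩q∣+∣p─q∣ p q)) (sym (ℕ.+-suc ∣ p ∩ q ∣ ∣ p ─ q ∣))
  ∣p∣≡∣p∩q∣+∣p─q∣ (false ∷ p) (true ∷ q) = ∣p∣≡∣p∩q∣+∣p─q∣ p q
  ∣p∣≡∣p∩q∣+∣p─q∣ (false ∷ p) (false ∷ q) = ∣p∣≡∣p∩q∣+∣p─q∣ p q

  ∣p─q∣≡∣q─p∣ : ∀ {n} (p q : Subset n) → ∣ p ∣ ≡ ∣ q ∣ → ∣ p ─ q ∣ ≡ ∣ q ─ p ∣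
  ∣p─q∣≡∣q─p∣ p q e = ℕ.+-cancelˡ-≡ ∣ p ∩ q ∣ _ _ (begin
    ∣ p ∩ q ∣ + ∣ p ─ q ∣  ≡⟨ sym (∣p∣≡∣p∩q∣+∣p─q∣ p q) ⟩
    ∣ p ∣                  ≡⟨ e ⟩
    ∣ q ∣                  ≡⟨ ∣p∣≡∣p∩q∣+∣p─q∣ q p ⟩
    ∣ q ∩ p ∣ + ∣ q ─ p ∣  ≡⟨ cong (λ x → ∣ x ∣ + ∣ q ─ p ∣) (∩-comm q p) ⟩
    ∣ p ∩ q ∣ + ∣ q ─ p ∣  ∎)
    where open ≡-Reasoning

  ∣p─q∣≡0⇒p⊑q : ∀ {n} (p q : Subset n) → ∣ p ─ q ∣ ≡ 0 → p ⊑ q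
  ∣p─q∣≡0⇒p⊑q [] [] e = []⊑
  ∣p─q∣≡0⇒p⊑q (true ∷ p) (true ∷ q) e = in⊑ (∣p─q∣≡0⇒p⊑q p q e)
  ∣p─q∣≡0⇒p⊑q (false ∷ p) (true ∷ q) e = out⊑ (∣p─q∣≡0⇒p⊑q p q e)
  ∣p─q∣≡0⇒p⊑q (false ∷ p) (false ∷ q) e = out⊑ (∣p─q∣≡0⇒p⊑q p q e)

  there-─ : ∀ {n b c} {p q : Subset n} → Σ[ u ∈ Fin n ] u ∈ p × u ∉ q →
          Σ[ u ∈ Fin (suc n) ] u ∈ (b ∷ p) × u ∉ (c ∷ q)
  there-─ (u , u∈p , u∉q) = _ , there u∈p , λ { (there m) → u∉q m }

  p─q-element : ∀ {n} (p q : Subset n) {k} → ∣ p ─ q ∣ ≡ suc k → Σ[ u ∈ Fin n ] u ∈ p × u ∉ q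
  p─q-element [] [] ()
  p─q-element (true ∷ p) (false ∷ q) e = _ , here , λ ()
  p─q-element (true ∷ p) (true ∷ q) e = there-─ (p─q-element p q e)
  p─q-element (false ∷ p) (true ∷ q) e = there-─ (p─q-element p q e)
  p─q-element (false ∷ p) (false ∷ q) e = there-─ (p─q-element p q e)

  -- Swapping u ∈ A ─ B for v ∈ B shrinks |A ─ B| by one: removing u lowers
  -- it, inserting v leaves it unchanged.
  ∣remove─∣ : ∀ {n} {p q : Subset n} {u} → u ∈ p → u ∉ q → suc ∣ remove p u ─ q ∣ ≡ ∣ p ─ q ∣
  ∣remove─∣ {q = false ∷ q} here h = refl
  ∣remove─∣ {q = true ∷ q} here h = ⊥-elim (h here)
  ∣remove─∣ {p = true ∷ p} {false ∷ q} (there m) h = cong suc (∣remove─∣ {p = p} m (λ x → h (there x)))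
  ∣remove─∣ {p = true ∷ p} {true ∷ q} (there m) h = ∣remove─∣ {p = p} m (λ x → h (there x))
  ∣remove─∣ {p = false ∷ p} {true ∷ q} (there m) h = ∣remove─∣ {p = p} m (λ x → h (there x))
  ∣remove─∣ {p = false ∷ p} {false ∷ q} (there m) h = ∣remove─∣ {p = p} m (λ x → h (there x))

  ∣insert─∣ : ∀ {n} {p q : Subset n} {v} → v ∈ q → ∣ insert p v ─ q ∣ ≡ ∣ p ─ q ∣
  ∣insert─∣ {p = true ∷ p} here = refl
  ∣insert─∣ {p = false ∷ p} here = refl
  ∣insert─∣ {p = true ∷ p} {false ∷ q} (there m) = cong suc (∣insert─∣ {p = p} m)
  ∣insert─∣ {p = true ∷ p} {true ∷ q} (there m) = ∣insert─∣ {p = p} m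
  ∣insert─∣ {p = false ∷ p} {true ∷ q} (there m) = ∣insert─∣ {p = p} m
  ∣insert─∣ {p = false ∷ p} {false ∷ q} (there m) = ∣insert─∣ {p = p} m

  ExchangeInvariant : ∀ {a} {Q : Set a} {n} → Subset n → ℕ → (Subset n → Q) → Set a
  ExchangeInvariant {n = n} V s c = ∀ (u v : Fin n) S → u ∈ V → v ∈ V → u ≢ v →
    S ⊑ V → u ∉ S → v ∉ S → ∣ S ∣ ≡ s → c (insert S u) ≡ c (insert S v)

  constant-on-layer : ∀ {a} {Q : Set a} {n} (V : Subset n) s (c : Subset n → Q) →
    ExchangeInvariant V s c → ∀ {A B} → A ⊑ V → B ⊑ V →
    ∣ A ∣ ≡ suc s → ∣ B ∣ ≡ suc s → c A ≡ c B
  constant-on-layer V s c exchange {A} {B} A⊑V B⊑V ∣A∣ ∣B∣ = go _ A A⊑V ∣A∣ refl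
    where
    go : ∀ d A → A ⊑ V → ∣ A ∣ ≡ suc s → ∣ A ─ B ∣ ≡ d → c A ≡ c B
    go zero A A⊑V ∣A∣ e = cong c (⊑-∣∣-≡ (∣p─q∣≡0⇒p⊑q A B e) (trans ∣A∣ (sym ∣B∣)))
    go (suc d) A A⊑V ∣A∣ e
      with p─q-element A B e | p─q-element B A (trans (sym (∣p─q∣≡∣q─p∣ A B (trans ∣A∣ (sym ∣B∣)))) e)
    ... | u , u∈A , u∉B | v , v∈B , v∉A = begin
      c A                  ≡⟨ cong c (sym (insert-remove u∈A)) ⟩
      c (insert S u)       ≡⟨ exchange u v S (∈-⊑ u∈A A⊑V) (∈-⊑ v∈B B⊑V) (λ { refl → v∉A u∈A })
                                S⊑V (∉-remove A u) v∉S ∣S∣ ⟩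
      c (insert S v)       ≡⟨ go d (insert S v) (insert-⊑ (∈-⊑ v∈B B⊑V) S⊑V) ∣S+v∣ closer ⟩
      c B                  ∎
      where
      open ≡-Reasoning
      S = remove A u
      S⊑V : S ⊑ V
      S⊑V = ⊑-trans (remove-⊑ A u) A⊑V
      v∉S : v ∉ S
      v∉S m = v∉A (∈-⊑ m (remove-⊑ A u))
      ∣S∣ : ∣ S ∣ ≡ s
      ∣S∣ = ℕ.suc-injective (trans (∣remove∣ A u∈A) ∣A∣)
      ∣S+v∣ : ∣ insert S v ∣ ≡ suc s
      ∣S+v∣ = trans (∣insert∣ S v∉S) (cong suc ∣S∣)
      closer : ∣ insert S v ─ B ∣ ≡ d
      closer = trans (∣insert─∣ {p = S} v∈B) (ℕ.suc-injective (trans (∣remove─∣ {p = A} u∈A u∉B) e))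


-- Sums of a rational function over the s-element subsets of a set e,
-- defined by recursion on the characteristic vector of e.  These are the
-- entries of the vector M_s^r(G) c for an edge e.
module LayerSums where
  open import Defs using (ℕtoℚ)
  open NaturalRationals using (ℕtoℚ-+)
  open Subsets
  open import Data.Nat as ℕ using (ℕ; zero; suc)
  import Data.Nat.Properties as ℕ
  open import Data.Nat.Combinatorics using (_C_; nCk+nC[k+1]≡[n+1]C[k+1])
  open import Data.Bool using (true; false)
  open import Data.Fin using (Fin; zero; suc)
  open import Data.Vec using ([]; _∷_; here; there)
  open import Data.Fin.Subset using (Subset; ∣_∣; _∉_; ⊥)
  open import Data.Empty using (⊥-elim)
  open import Data.Rational using (ℚ; 0ℚ; _+_; _*_; _-_)
  open import Data.Rational.Properties using (+-identityʳ; *-identityˡ; *-zeroˡ; *-distribʳ-+)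
  open import Data.Rational.Solver using (module +-*-Solver)
  open +-*-Solver
  open import Relation.Binary.PropositionalEquality

  mutual
    layerSum : ∀ {n} → Subset n → ℕ → (Subset n → ℚ) → ℚ
    layerSum [] zero f = f []
    layerSum [] (suc s) f = 0ℚ
    layerSum (false ∷ e) s f = layerSum e s (λ S → f (false ∷ S))
    layerSum (true ∷ e) s f = layerSum e s (λ S → f (false ∷ S)) + layerSum⁻ e s (λ S → f (true ∷ S))

    layerSum⁻ : ∀ {n} → Subset n → ℕ → (Subset n → ℚ) → ℚ
    layerSum⁻ e zero g = 0ℚ
    layerSum⁻ e (suc s) g = layerSum e s g

  layerSum-zero : ∀ {n} (e : Subset n) f → layerSum e 0 f ≡ f ⊥
  layerSum-zero [] f = refl
  layerSum-zero (false ∷ e) f = layerSum-zero e _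
  layerSum-zero (true ∷ e) f = trans (+-identityʳ _) (layerSum-zero e _)

  layerSum-─ : ∀ {n} (e : Subset n) s (f g : Subset n → ℚ) →
               layerSum e s (λ S → f S - g S) ≡ layerSum e s f - layerSum e s g
  layerSum-─ [] zero f g = refl
  layerSum-─ [] (suc s) f g = refl
  layerSum-─ (false ∷ e) s f g = layerSum-─ e s _ _
  layerSum-─ (true ∷ e) zero f g =
    trans (cong (_+ 0ℚ) (layerSum-─ e zero _ _))
          (rearrange (layerSum e zero (λ S → f (false ∷ S))) (layerSum e zero (λ S → g (false ∷ S))))
    where
    rearrange : ∀ a b → (a - b) + 0ℚ ≡ (a + 0ℚ) - (b + 0ℚ)
    rearrange = solve 2 (λ a b → (a :- b) :+ con 0ℚ := (a :+ con 0ℚ) :- (b :+ con 0ℚ)) refl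
  layerSum-─ (true ∷ e) (suc s) f g =
    trans (cong₂ _+_ (layerSum-─ e (suc s) fF gF) (layerSum-─ e s fT gT))
          (rearrange (layerSum e (suc s) fF) (layerSum e (suc s) gF) (layerSum e s fT) (layerSum e s gT))
    where
    fF gF fT gT : Subset _ → ℚ
    fF S = f (false ∷ S)
    gF S = g (false ∷ S)
    fT S = f (true ∷ S)
    gT S = g (true ∷ S)
    rearrange : ∀ a b c d → (a - b) + (c - d) ≡ (a + c) - (b + d)
    rearrange = solve 4 (λ a b c d → (a :- b) :+ (c :- d) := (a :+ c) :- (b :+ d)) refl

  -- Pascal's rule for layer sums: the s-subsets of T ∪ {u} either avoid u,
  -- or are S ∪ {u} for an (s-1)-subset S of T.
  layerSum-insert : ∀ {n} (T : Subset n) {u} → u ∉ T → ∀ s (f : Subset n → ℚ) →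
    layerSum (insert T u) s f ≡ layerSum T s f + layerSum⁻ T s (λ S → f (insert S u))
  layerSum-insert (true ∷ T) {zero} h s f = ⊥-elim (h here)
  layerSum-insert (false ∷ T) {zero} h zero f = refl
  layerSum-insert (false ∷ T) {zero} h (suc s) f = refl
  layerSum-insert (false ∷ T) {suc u} h zero f = layerSum-insert T (λ m → h (there m)) zero _
  layerSum-insert (false ∷ T) {suc u} h (suc s) f = layerSum-insert T (λ m → h (there m)) (suc s) _
  layerSum-insert (true ∷ T) {suc u} h zero f =
    cong (_+ 0ℚ) (layerSum-insert T (λ m → h (there m)) zero _)
  layerSum-insert (true ∷ T) {suc u} h (suc s) f =
    trans (cong₂ _+_ (layerSum-insert T h′ (suc s) fF) (layerSum-insert T h′ s fT))
          (swap (layerSum T (suc s) fF) (layerSum⁻ T (suc s) (λ S → fF (insert S u)))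
                (layerSum T s fT) (layerSum⁻ T s (λ S → fT (insert S u))))
    where
    fF fT : Subset _ → ℚ
    fF S = f (false ∷ S)
    fT S = f (true ∷ S)
    h′ : u ∉ T
    h′ m = h (there m)
    swap : ∀ a b c d → (a + b) + (c + d) ≡ (a + c) + (b + d)
    swap = solve 4 (λ a b c d → (a :+ b) :+ (c :+ d) := (a :+ c) :+ (b :+ d)) refl

  layerSum-constant : ∀ {n} (e : Subset n) s (f : Subset n → ℚ) a →
    (∀ S → S ⊑ e → ∣ S ∣ ≡ s → f S ≡ a) → layerSum e s f ≡ ℕtoℚ (∣ e ∣ C s) * a
  layerSum-constant [] zero f a h = trans (h [] []⊑ refl) (sym (*-identityˡ a))
  layerSum-constant [] (suc s) f a h = sym (*-zeroˡ a)
  layerSum-constant (false ∷ e) s f a h =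
    layerSum-constant e s _ a (λ S S⊑e ∣S∣ → h (false ∷ S) (out⊑ S⊑e) ∣S∣)
  layerSum-constant (true ∷ e) zero f a h =
    trans (+-identityʳ _) (layerSum-constant e zero _ a (λ S S⊑e ∣S∣ → h (false ∷ S) (out⊑ S⊑e) ∣S∣))
  layerSum-constant (true ∷ e) (suc s) f a h = begin
    layerSum e (suc s) (λ S → f (false ∷ S)) + layerSum e s (λ S → f (true ∷ S))
      ≡⟨ cong₂ _+_ (layerSum-constant e (suc s) _ a (λ S S⊑e ∣S∣ → h (false ∷ S) (out⊑ S⊑e) ∣S∣))
                   (layerSum-constant e s _ a (λ S S⊑e ∣S∣ → h (true ∷ S) (in⊑ S⊑e) (cong suc ∣S∣))) ⟩
    ℕtoℚ (∣ e ∣ C suc s) * a + ℕtoℚ (∣ e ∣ C s) * a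
      ≡⟨ sym (*-distribʳ-+ a (ℕtoℚ (∣ e ∣ C suc s)) (ℕtoℚ (∣ e ∣ C s))) ⟩
    (ℕtoℚ (∣ e ∣ C suc s) + ℕtoℚ (∣ e ∣ C s)) * a
      ≡⟨ cong (_* a) (sym (ℕtoℚ-+ (∣ e ∣ C suc s) (∣ e ∣ C s))) ⟩
    ℕtoℚ (∣ e ∣ C suc s ℕ.+ ∣ e ∣ C s) * a
      ≡⟨ cong (λ x → ℕtoℚ x * a) (trans (ℕ.+-comm (∣ e ∣ C suc s) (∣ e ∣ C s))
                                        (nCk+nC[k+1]≡[n+1]C[k+1] ∣ e ∣ s)) ⟩
    ℕtoℚ (suc ∣ e ∣ C suc s) * a ∎
    where open ≡-Reasoning


-- Let 'bad' mark the r-subsets of V that are not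
-- edges.
module Vanishing where
  open import Defs using (ℕtoℚ)
  open NaturalRationals using (suc-*-cancel)
  open Subsets
  open Exchange using (ExchangeInvariant; constant-on-layer)
  open LayerSums
  open Binomials using (C-positive)
  open import Data.Nat as ℕ using (ℕ; zero; suc; _≤_)
  open import Data.Nat.Combinatorics using (_C_)
  open import Data.Fin using (Fin)
  open import Data.Fin.Subset using (Subset; ∣_∣; _∈_; _∉_)
  open import Data.Empty using () renaming (⊥ to Empty)
  open import Data.Sum using (_⊎_; inj₁; inj₂)
  import Data.Sum as Sum
  open import Data.Product using (Σ-syntax; _×_; _,_)
  open import Relation.Nullary using (¬_)
  open import Data.Rational using (ℚ; 0ℚ; _+_; _*_; _-_)
  open import Data.Rational.Properties using (+-0-group)
  open import Algebra.Properties.Group +-0-group using (x∙y⁻¹≈ε⇒x≈y)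
  open import Data.Rational.Solver using (module +-*-Solver)
  open +-*-Solver
  open import Relation.Binary.PropositionalEquality

  Bad₂ : ∀ {n} → (Subset n → Set) → Fin n → Fin n → Subset n → Set
  Bad₂ bad u v T = bad (insert T u) ⊎ bad (insert T v)

  Certificate : ∀ {n} → ℕ → ℕ → Subset n → (Subset n → Set) → Set
  Certificate {n} zero r V bad = Σ[ e ∈ Subset n ] e ⊑ V × ∣ e ∣ ≡ r × ¬ bad e
  Certificate (suc s) zero V bad = Empty
  Certificate {n} (suc s) (suc r) V bad =
    (Σ[ u ∈ Fin n ] Σ[ v ∈ Fin n ] u ∈ V × v ∈ V × u ≢ v) ×
    (∀ u v → u ∈ V → v ∈ V → u ≢ v → Certificate s r (remove (remove V u) v) (Bad₂ bad u v))

  certificate-edge : ∀ {n} s r (V : Subset n) bad → Certificate s r V bad →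
                     Σ[ e ∈ Subset n ] e ⊑ V × ∣ e ∣ ≡ r × ¬ bad e
  certificate-edge zero r V bad cert = cert
  certificate-edge (suc s) (suc r) V bad ((u , v , u∈V , v∈V , u≢v) , next)
    with certificate-edge s r _ _ (next u v u∈V v∈V u≢v)
  ... | T , T⊑V-u-v , ∣T∣ , good with ⊑-remove⁻ v T⊑V-u-v
  ... | T⊑V-u , _ with ⊑-remove⁻ u T⊑V-u
  ... | T⊑V , u∉T = insert T u , insert-⊑ u∈V T⊑V , trans (∣insert∣ T u∉T) (cong suc ∣T∣) ,
                    λ b → good (inj₁ b)

  certificate-s≤r : ∀ {n} s r (V : Subset n) bad → Certificate s r V bad → s ≤ r
  certificate-s≤r zero r V bad cert = ℕ.z≤n
  certificate-s≤r (suc s) (suc r) V bad ((u , v , u∈V , v∈V , u≢v) , next) =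
    ℕ.s≤s (certificate-s≤r s r _ _ (next u v u∈V v∈V u≢v))

  certificate-mono : ∀ {n} s r (V : Subset n) (bad₁ bad₂ : Subset n → Set) →
    (∀ T → bad₂ T → bad₁ T) → Certificate s r V bad₁ → Certificate s r V bad₂
  certificate-mono zero r V bad₁ bad₂ imp (e , e⊑V , ∣e∣ , good) = e , e⊑V , ∣e∣ , λ b → good (imp e b)
  certificate-mono (suc s) (suc r) V bad₁ bad₂ imp (pair , next) = pair , λ u v u∈V v∈V u≢v →
    certificate-mono s r _ (Bad₂ bad₁ u v) (Bad₂ bad₂ u v)
      (λ T → Sum.map (imp (insert T u)) (imp (insert T v))) (next u v u∈V v∈V u≢v)

  EdgeEquations : ∀ {n} → ℕ → ℕ → Subset n → (Subset n → Set) → (Subset n → ℚ) → Set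
  EdgeEquations s r V bad c = ∀ e → e ⊑ V → ∣ e ∣ ≡ r → ¬ bad e → layerSum e s c ≡ 0ℚ

  -- Subtracting the equations of T ∪ {u} and T ∪ {v}: the differences
  -- c(S ∪ {u}) - c(S ∪ {v}) satisfy the equations one level lower.
  difference-equations : ∀ {n} s r (V : Subset n) bad (c : Subset n → ℚ) {u v} →
    EdgeEquations (suc s) (suc r) V bad c → u ∈ V → v ∈ V →
    EdgeEquations s r (remove (remove V u) v) (Bad₂ bad u v) (λ S → c (insert S u) - c (insert S v))
  difference-equations s r V bad c {u} {v} eqs u∈V v∈V T T⊑V-u-v ∣T∣ good
    with ⊑-remove⁻ v T⊑V-u-v
  ... | T⊑V-u , v∉T with ⊑-remove⁻ u T⊑V-u
  ... | T⊑V , u∉T = begin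
    layerSum T s (λ S → c (insert S u) - c (insert S v))
      ≡⟨ layerSum-─ T s (λ S → c (insert S u)) (λ S → c (insert S v)) ⟩
    layerSum T s (λ S → c (insert S u)) - layerSum T s (λ S → c (insert S v))
      ≡⟨ cancel-common (layerSum T (suc s) c) _ _ (added u u∈V u∉T inj₁) (added v v∈V v∉T inj₂) ⟩
    0ℚ ∎
    where
    open ≡-Reasoning
    cancel-common : ∀ x a b → x + a ≡ 0ℚ → x + b ≡ 0ℚ → a - b ≡ 0ℚ
    cancel-common x a b xa xb = trans (shift x a b) (cong₂ _-_ xa xb)
      where
      shift : ∀ x a b → a - b ≡ (x + a) - (x + b)
      shift = solve 3 (λ x a b → a :- b := (x :+ a) :- (x :+ b)) refl
    added : ∀ w → w ∈ V → w ∉ T → (bad (insert T w) → Bad₂ bad u v T) →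
            layerSum T (suc s) c + layerSum T s (λ S → c (insert S w)) ≡ 0ℚ
    added w w∈V w∉T which = trans (sym (layerSum-insert T w∉T (suc s) c))
      (eqs (insert T w) (insert-⊑ w∈V T⊑V) (trans (∣insert∣ T w∉T) (cong suc ∣T∣)) (λ b → good (which b)))

  vanishing : ∀ s r {n} (V : Subset n) bad → Certificate s r V bad →
    (c : Subset n → ℚ) → EdgeEquations s r V bad c → ∀ S → S ⊑ V → ∣ S ∣ ≡ s → c S ≡ 0ℚ
  vanishing zero r V bad (e , e⊑V , ∣e∣ , good) c eqs S S⊑V ∣S∣ = begin
    c S             ≡⟨ cong c (∣p∣≡0⇒p≡⊥ S ∣S∣) ⟩
    c _             ≡⟨ sym (layerSum-zero e c) ⟩
    layerSum e 0 c  ≡⟨ eqs e e⊑V ∣e∣ good ⟩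
    0ℚ              ∎
    where open ≡-Reasoning
  vanishing (suc s) (suc r) V bad cert@(_ , next) c eqs S S⊑V ∣S∣ with certificate-edge (suc s) (suc r) V bad cert
  ... | e , e⊑V , ∣e∣ , good
    with C-positive (subst (suc s ≤_) (sym ∣e∣) (certificate-s≤r (suc s) (suc r) V bad cert))
  ... | k , C≡suc = suc-*-cancel k (c S) (begin
    ℕtoℚ (suc k) * c S          ≡⟨ cong (λ x → ℕtoℚ x * c S) (sym C≡suc) ⟩
    ℕtoℚ (∣ e ∣ C suc s) * c S  ≡⟨ sym (layerSum-constant e (suc s) c (c S) constant) ⟩
    layerSum e (suc s) c        ≡⟨ eqs e e⊑V ∣e∣ good ⟩
    0ℚ                          ∎)
    where
    open ≡-Reasoning
    -- by the level-s certificates, c is invariant under exchanges ...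
    exchange : ExchangeInvariant V s c
    exchange u v T u∈V v∈V u≢v T⊑V u∉T v∉T ∣T∣ = x∙y⁻¹≈ε⇒x≈y _ _
      (vanishing s r _ _ (next u v u∈V v∈V u≢v) _ (difference-equations s r V bad c eqs u∈V v∈V)
        T (⊑-remove⁺ v (⊑-remove⁺ u T⊑V u∉T) v∉T) ∣T∣)
    constant : ∀ A → A ⊑ e → ∣ A ∣ ≡ suc s → c A ≡ c S
    constant A A⊑e ∣A∣ = constant-on-layer V s c exchange (⊑-trans A⊑e e⊑V) S⊑V ∣A∣ ∣S∣


module RowSums where
  open import Defs
  open LayerSums
  open import Data.Nat as ℕ using (ℕ; zero; suc)
  open import Data.Nat.Properties using (_≟_)
  open import Data.Bool using (true; false; if_then_else_)
  open import Data.Vec using ([]; _∷_)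
  open import Data.Fin.Subset using (Subset; ∣_∣)
  open import Data.Fin.Subset.Properties using (_⊆?_)
  open import Data.List using (List; []; _∷_; _++_; map; filter)
  open import Data.List.Properties using (map-∘; map-cong)
  open import Data.Rational using (ℚ; 0ℚ; _+_; _*_)
  open import Data.Rational.Properties using (+-identityˡ; +-identityʳ; +-assoc; +-comm; *-identityʳ; *-zeroʳ)
  open import Relation.Nullary using (does; yes; no)
  open import Relation.Unary using (Decidable)
  open import Relation.Binary.PropositionalEquality
  open ≡-Reasoning

  sum-++ : ∀ {A : Set} (f : A → ℚ) xs ys → sumℚ (map f (xs ++ ys)) ≡ sumℚ (map f xs) + sumℚ (map f ys)
  sum-++ f [] ys = sym (+-identityˡ _)
  sum-++ f (x ∷ xs) ys = trans (cong (f x +_) (sum-++ f xs ys)) (sym (+-assoc (f x) _ _))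

  sum-zero : ∀ {A : Set} {f : A → ℚ} → (∀ x → f x ≡ 0ℚ) → ∀ xs → sumℚ (map f xs) ≡ 0ℚ
  sum-zero h [] = refl
  sum-zero h (x ∷ xs) = trans (cong₂ _+_ (h x) (sum-zero h xs)) refl

  sum-filter : ∀ {A : Set} {P : A → Set} (P? : Decidable P) (g : A → ℚ) xs →
    sumℚ (map g (filter P? xs)) ≡ sumℚ (map (λ x → if does (P? x) then g x else 0ℚ) xs)
  sum-filter P? g [] = refl
  sum-filter P? g (x ∷ xs) with does (P? x)
  ... | true = cong (g x +_) (sum-filter P? g xs)
  ... | false = trans (sum-filter P? g xs) (sym (+-identityˡ _))

  inclEntry-does : ∀ {n} (e S : Subset n) → inclEntry e S ≡ (if does (S ⊆? e) then ℕtoℚ 1 else 0ℚ)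
  inclEntry-does e S with S ⊆? e
  ... | yes _ = refl
  ... | no _ = refl

  term : ∀ {n} → Subset n → ℕ → (Subset n → ℚ) → Subset n → ℚ
  term e s c p = if does (∣ p ∣ ≟ s) then c p * inclEntry e p else 0ℚ

  term-absent : ∀ {n} b (e : Subset n) s c p → term (b ∷ e) s c (false ∷ p) ≡ term e s (λ S → c (false ∷ S)) p
  term-absent b e s c p with does (∣ p ∣ ≟ s)
  ... | true = cong (c (false ∷ p) *_) (trans (inclEntry-does (b ∷ e) (false ∷ p)) (sym (inclEntry-does e p)))
  ... | false = refl

  term-shared : ∀ {n} (e : Subset n) s c p → term (true ∷ e) (suc s) c (true ∷ p) ≡ term e s (λ S → c (true ∷ S)) p
  term-shared e s c p with does (∣ p ∣ ≟ s)
  ... | true = cong (c (true ∷ p) *_) (trans (inclEntry-does (true ∷ e) (true ∷ p)) (sym (inclEntry-does e p)))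
  ... | false = refl

  term-excluded : ∀ {n} (e : Subset n) s c p → term (false ∷ e) s c (true ∷ p) ≡ 0ℚ
  term-excluded e s c p with does (suc ∣ p ∣ ≟ s)
  ... | true = trans (cong (c (true ∷ p) *_) (inclEntry-does (false ∷ e) (true ∷ p))) (*-zeroʳ (c (true ∷ p)))
  ... | false = refl

  sum-term : ∀ n (e : Subset n) s c → sumℚ (map (term e s c) (allSubsets n)) ≡ layerSum e s c
  sum-term zero [] zero c = begin
    c [] * inclEntry [] [] + 0ℚ  ≡⟨ +-identityʳ _ ⟩
    c [] * inclEntry [] []       ≡⟨ cong (c [] *_) (inclEntry-does [] []) ⟩
    c [] * ℕtoℚ 1                ≡⟨ *-identityʳ (c []) ⟩
    c []                         ∎
  sum-term zero [] (suc s) c = refl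
  sum-term (suc n) (b ∷ e) s c = begin
    sumℚ (map (term (b ∷ e) s c) (map (true ∷_) A ++ map (false ∷_) A))
      ≡⟨ sum-++ (term (b ∷ e) s c) (map (true ∷_) A) (map (false ∷_) A) ⟩
    sumℚ (map (term (b ∷ e) s c) (map (true ∷_) A)) + sumℚ (map (term (b ∷ e) s c) (map (false ∷_) A))
      ≡⟨ cong₂ _+_ (cong sumℚ (sym (map-∘ A))) (cong sumℚ (sym (map-∘ A))) ⟩
    sumℚ (map (λ p → term (b ∷ e) s c (true ∷ p)) A) + sumℚ (map (λ p → term (b ∷ e) s c (false ∷ p)) A)
      ≡⟨ cong (sumℚ (map (λ p → term (b ∷ e) s c (true ∷ p)) A) +_)
              (trans (cong sumℚ (map-cong (term-absent b e s c) A)) (sum-term n e s _)) ⟩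
    sumℚ (map (λ p → term (b ∷ e) s c (true ∷ p)) A) + layerSum e s (λ S → c (false ∷ S))
      ≡⟨ with-head b s ⟩
    layerSum (b ∷ e) s c ∎
    where
    A = allSubsets n
    with-head : ∀ b s → sumℚ (map (λ p → term (b ∷ e) s c (true ∷ p)) A) + layerSum e s (λ S → c (false ∷ S))
                        ≡ layerSum (b ∷ e) s c
    with-head false s = trans (cong (_+ x) (sum-zero (term-excluded e s c) A)) (+-identityˡ x)
      where x = layerSum e s (λ S → c (false ∷ S))
    with-head true zero = begin
      sumℚ (map (λ p → term (true ∷ e) zero c (true ∷ p)) A) + x  ≡⟨ cong (_+ x) (sum-zero (λ _ → refl) A) ⟩
      0ℚ + x                                                     ≡⟨ +-identityˡ x ⟩
      x                                                          ≡⟨ sym (+-identityʳ x) ⟩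
      x + 0ℚ                                                     ∎
      where x = layerSum e zero (λ S → c (false ∷ S))
    with-head true (suc s) = begin
      sumℚ (map (λ p → term (true ∷ e) (suc s) c (true ∷ p)) A) + x
        ≡⟨ cong (_+ x) (trans (cong sumℚ (map-cong (term-shared e s c) A)) (sum-term n e s _)) ⟩
      layerSum e s (λ S → c (true ∷ S)) + x
        ≡⟨ +-comm (layerSum e s (λ S → c (true ∷ S))) x ⟩
      x + layerSum e s (λ S → c (true ∷ S)) ∎
      where x = layerSum e (suc s) (λ S → c (false ∷ S))

  row-sum : ∀ {n} (e : Subset n) s c →
    sumℚ (map (λ S → c S * inclEntry e S) (kSets n s)) ≡ layerSum e s c
  row-sum {n} e s c = trans (sum-filter (λ p → ∣ p ∣ ≟ s) (λ S → c S * inclEntry e S) (allSubsets n))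
                            (sum-term n e s c)


module Enumeration where
  open import Defs using (allSubsets; kSets)
  open Subsets using (_⊑_; []⊑; out⊑; in⊑; ⊑-⊤)
  open import Data.Nat as ℕ using (ℕ; zero; suc; _≤_; _+_)
  import Data.Nat.Properties as ℕ
  open import Data.Nat.Properties using (_≟_)
  open import Data.Nat.Combinatorics using (_C_; nCk+nC[k+1]≡[n+1]C[k+1])
  open import Data.Bool using (true; false; _∧_)
  open import Data.Bool.Properties using (∧-zeroʳ)
  open import Data.Vec using ([]; _∷_)
  open import Data.Fin.Subset using (Subset; ∣_∣; ⊤)
  open import Data.Fin.Subset.Properties using (∣⊤∣≡n)
  open import Data.List using (List; []; _∷_; _++_; map; filter; length)
  open import Data.List.Properties using (filter-++; length-++; length-removeAt′)
  open import Data.List.Membership.Propositional using (_∈_)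
  open import Data.List.Membership.Propositional.Properties using (∈-++⁺ˡ; ∈-++⁺ʳ; ∈-map⁺; ∈-map⁻; ∈-filter⁺)
  open import Data.List.Relation.Unary.Any using (here; there; _─_)
  open import Data.List.Relation.Unary.All using ([]; lookup)
  open import Data.List.Relation.Unary.AllPairs using ([]; _∷_)
  open import Data.List.Relation.Unary.Unique.Propositional using (Unique)
  import Data.List.Relation.Unary.Unique.Propositional.Properties as Unique
  open import Data.Empty using (⊥-elim)
  open import Data.Product using (_×_; _,_)
  open import Relation.Nullary using (¬_; Dec; does; yes; no)
  open import Relation.Nullary.Decidable using (map′; _×-dec_; dec-true)
  open import Relation.Unary using (Decidable)
  open import Relation.Binary.PropositionalEquality

  ∈-allSubsets : ∀ {n} (p : Subset n) → p ∈ allSubsets n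
  ∈-allSubsets [] = here refl
  ∈-allSubsets {suc n} (true ∷ p) = ∈-++⁺ˡ (∈-map⁺ (true ∷_) (∈-allSubsets p))
  ∈-allSubsets {suc n} (false ∷ p) = ∈-++⁺ʳ (map (true ∷_) (allSubsets n)) (∈-map⁺ (false ∷_) (∈-allSubsets p))

  allSubsets-unique : ∀ n → Unique (allSubsets n)
  allSubsets-unique zero = [] ∷ []
  allSubsets-unique (suc n) = Unique.++⁺ (Unique.map⁺ tail-injective (allSubsets-unique n))
                                         (Unique.map⁺ tail-injective (allSubsets-unique n)) different-heads
    where
    tail-injective : ∀ {b} {p q : Subset n} → (b ∷ p) ≡ (b ∷ q) → p ≡ q
    tail-injective refl = refl
    different-heads : ∀ {p} → ¬ (p ∈ map (true ∷_) (allSubsets n) × p ∈ map (false ∷_) (allSubsets n))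
    different-heads (p∈T , p∈F) with ∈-map⁻ (true ∷_) p∈T | ∈-map⁻ (false ∷_) p∈F
    ... | _ , _ , refl | _ , _ , ()

  _⊑?_ : ∀ {n} (p q : Subset n) → Dec (p ⊑ q)
  [] ⊑? [] = yes []⊑
  (false ∷ p) ⊑? (b ∷ q) = map′ out⊑ (λ { (out⊑ s) → s }) (p ⊑? q)
  (true ∷ p) ⊑? (true ∷ q) = map′ in⊑ (λ { (in⊑ s) → s }) (p ⊑? q)
  (true ∷ p) ⊑? (false ∷ q) = no (λ ())

  InLayer : ∀ {n} → Subset n → ℕ → Subset n → Set
  InLayer V t p = p ⊑ V × ∣ p ∣ ≡ t

  InLayer? : ∀ {n} (V : Subset n) t → Decidable (InLayer V t)
  InLayer? V t p = (p ⊑? V) ×-dec (∣ p ∣ ≟ t)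

  layer : ∀ {n} → Subset n → ℕ → List (Subset n)
  layer {n} V t = filter (InLayer? V t) (allSubsets n)

  module _ {A : Set} where
    length-filter-map : ∀ {B : Set} {P : B → Set} (P? : Decidable P) (g : A → B) xs →
      length (filter P? (map g xs)) ≡ length (filter (λ x → P? (g x)) xs)
    length-filter-map P? g [] = refl
    length-filter-map P? g (x ∷ xs) with does (P? (g x))
    ... | true = cong suc (length-filter-map P? g xs)
    ... | false = length-filter-map P? g xs

    length-filter-cong : ∀ {P Q : A → Set} (P? : Decidable P) (Q? : Decidable Q) →
      (∀ x → does (P? x) ≡ does (Q? x)) → ∀ xs → length (filter P? xs) ≡ length (filter Q? xs)
    length-filter-cong P? Q? h [] = refl
    length-filter-cong P? Q? h (x ∷ xs) with does (P? x) | does (Q? x) | h x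
    ... | true | true | _ = cong suc (length-filter-cong P? Q? h xs)
    ... | false | false | _ = length-filter-cong P? Q? h xs

    length-filter-none : ∀ {P : A → Set} (P? : Decidable P) →
      (∀ x → does (P? x) ≡ false) → ∀ xs → length (filter P? xs) ≡ 0
    length-filter-none P? h [] = refl
    length-filter-none P? h (x ∷ xs) with does (P? x) | h x
    ... | false | _ = length-filter-none P? h xs

  length-layer : ∀ {n} (V : Subset n) t → length (layer V t) ≡ ∣ V ∣ C t
  length-layer {zero} [] zero = refl
  length-layer {zero} [] (suc t) = refl
  length-layer {suc n} (b ∷ V) t = begin
    length (filter P? (map (true ∷_) A ++ map (false ∷_) A))
      ≡⟨ cong length (filter-++ P? (map (true ∷_) A) (map (false ∷_) A)) ⟩
    length (filter P? (map (true ∷_) A) ++ filter P? (map (false ∷_) A))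
      ≡⟨ length-++ (filter P? (map (true ∷_) A)) ⟩
    length (filter P? (map (true ∷_) A)) + length (filter P? (map (false ∷_) A))
      ≡⟨ cong₂ _+_ (length-filter-map P? (true ∷_) A) (length-filter-map P? (false ∷_) A) ⟩
    length (filter (λ p → P? (true ∷ p)) A) + length (filter (λ p → P? (false ∷ p)) A)
      ≡⟨ cong (length (filter (λ p → P? (true ∷ p)) A) +_)
              (trans (length-filter-cong _ (InLayer? V t) (λ _ → refl) A) (length-layer V t)) ⟩
    length (filter (λ p → P? (true ∷ p)) A) + ∣ V ∣ C t
      ≡⟨ with-head b t ⟩
    ∣ b ∷ V ∣ C t ∎
    where
    open ≡-Reasoning
    A = allSubsets n
    P? = InLayer? (b ∷ V) t
    with-head : ∀ b t → length (filter (λ p → InLayer? (b ∷ V) t (true ∷ p)) A) + ∣ V ∣ C t ≡ ∣ b ∷ V ∣ C t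
    with-head false t = cong (_+ ∣ V ∣ C t) (length-filter-none _ (λ _ → refl) A)
    with-head true zero = cong (_+ ∣ V ∣ C zero) (length-filter-none _ (λ p → ∧-zeroʳ (does (p ⊑? V))) A)
    with-head true (suc t) =
      trans (cong (_+ ∣ V ∣ C suc t) (trans (length-filter-cong _ (InLayer? V t) (λ _ → refl) A) (length-layer V t)))
            (nCk+nC[k+1]≡[n+1]C[k+1] ∣ V ∣ t)

  length-kSets : ∀ n s → length (kSets n s) ≡ n C s
  length-kSets n s = begin
    length (kSets n s)     ≡⟨ length-filter-cong (λ p → ∣ p ∣ ≟ s) (InLayer? ⊤ s)
                                (λ p → cong (_∧ does (∣ p ∣ ≟ s)) (sym (dec-true (p ⊑? ⊤) (⊑-⊤ p)))) (allSubsets n) ⟩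
    length (layer (⊤ {n}) s) ≡⟨ length-layer (⊤ {n}) s ⟩
    ∣ ⊤ {n} ∣ C s          ≡⟨ cong (_C s) (∣⊤∣≡n n) ⟩
    n C s                  ∎
    where open ≡-Reasoning

  kSets-unique : ∀ n s → Unique (kSets n s)
  kSets-unique n s = Unique.filter⁺ _ (allSubsets-unique n)

  ∈-kSets : ∀ {n s} {S : Subset n} → ∣ S ∣ ≡ s → S ∈ kSets n s
  ∈-kSets {s = s} {S} ∣S∣ = ∈-filter⁺ (λ p → ∣ p ∣ ≟ s) (∈-allSubsets S) ∣S∣

  -- Pigeonhole principle for lists: an injection of a duplicate-free list xs
  -- into ys gives |xs| ≤ |ys|.  Removing the image of the head of xs from ys
  -- keeps the images of the other elements.
  module _ {A B : Set} where
    ∈-─ : ∀ {x y : B} {ys} → y ∈ ys → y ≢ x → (p : x ∈ ys) → y ∈ (ys ─ p)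
    ∈-─ (here refl) y≢x (here refl) = ⊥-elim (y≢x refl)
    ∈-─ (there q) y≢x (here refl) = q
    ∈-─ (here e) y≢x (there p) = here e
    ∈-─ (there q) y≢x (there p) = there (∈-─ q y≢x p)

    pigeonhole : (f : A → B) (xs : List A) (ys : List B) → Unique xs →
      (∀ {x y} → x ∈ xs → y ∈ xs → f x ≡ f y → x ≡ y) →
      (∀ {x} → x ∈ xs → f x ∈ ys) → length xs ≤ length ys
    pigeonhole f [] ys unique injective into = ℕ.z≤n
    pigeonhole f (x ∷ xs) ys (x∉xs ∷ unique) injective into =
      subst (suc (length xs) ≤_) (sym (length-removeAt′ ys _))
        (ℕ.s≤s (pigeonhole f xs (ys ─ fx∈ys) unique (λ a b e → injective (there a) (there b) e)
          (λ {z} z∈xs → ∈-─ (into (there z∈xs))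
                              (λ e → lookup x∉xs z∈xs (injective (here refl) (there z∈xs) (sym e))) fx∈ys)))
      where
      fx∈ys = into (here refl)


-- Since T ↦ T ∪ X is injective on subsets of V, at most deg_F(X)
-- sets are blocked through X; so if Σ_{X ∈ L} deg_F(X) < C(|V|, t) some
-- t-subset of V is not blocked.
module Blocking where
  open import Defs using (allSubsets; degree; _∈ˢ?_)
  open Subsets
  open Enumeration
  open import Data.Nat as ℕ using (ℕ; _≤_; _<_)
  import Data.Nat.Properties as ℕ
  open import Data.Nat.ListAction using (sum)
  open import Data.Nat.Combinatorics using (_C_)
  open import Data.Bool using (true; false)
  open import Data.Vec using ([]; _∷_)
  open import Data.Fin.Subset using (Subset; ∣_∣; _∪_; _∩_; ∁)
  open import Data.Fin.Subset.Properties using (_⊆?_; q⊆p∪q)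
  open import Data.List using (List; []; _∷_; map; filter; length)
  open import Data.List.Membership.Propositional using (_∈_; lose; find)
  open import Data.List.Membership.Propositional.Properties using (∈-filter⁺; ∈-filter⁻)
  open import Data.List.Relation.Unary.Any as Any using (Any; here; there; any?)
  open import Data.List.Relation.Unary.All as All using (All; []; _∷_)
  import Data.List.Relation.Unary.Unique.Propositional.Properties as Unique
  open import Data.Empty using (⊥-elim)
  open import Data.Product using (Σ-syntax; _×_; _,_; proj₁; proj₂)
  open import Relation.Nullary using (¬_; does; yes; no; ¬?)
  open import Relation.Nullary.Decidable using (decidable-stable)
  open import Relation.Unary using (Decidable)
  open import Relation.Binary.PropositionalEquality

  Disjoint : ∀ {n} → Subset n → Subset n → Set
  Disjoint X V = X ⊑ ∁ V

  ∪-∩-cancel : ∀ {n} {T V X : Subset n} → T ⊑ V → Disjoint X V → (T ∪ X) ∩ V ≡ T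
  ∪-∩-cancel []⊑ []⊑ = refl
  ∪-∩-cancel {V = false ∷ V} (out⊑ s) (out⊑ d) = cong (false ∷_) (∪-∩-cancel s d)
  ∪-∩-cancel {V = false ∷ V} (out⊑ s) (in⊑ d) = cong (false ∷_) (∪-∩-cancel s d)
  ∪-∩-cancel {V = true ∷ V} (out⊑ s) (out⊑ d) = cong (false ∷_) (∪-∩-cancel s d)
  ∪-∩-cancel (in⊑ s) (out⊑ d) = cong (true ∷_) (∪-∩-cancel s d)

  ∪-injective : ∀ {n} {T₁ T₂ V X : Subset n} → T₁ ⊑ V → T₂ ⊑ V → Disjoint X V → T₁ ∪ X ≡ T₂ ∪ X → T₁ ≡ T₂
  ∪-injective {V = V} s₁ s₂ d e =
    trans (sym (∪-∩-cancel s₁ d)) (trans (cong (_∩ V) e) (∪-∩-cancel s₂ d))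

  module _ {B : Set} where
    sum-mono : (L : List B) (f g : B → ℕ) → All (λ X → f X ≤ g X) L → sum (map f L) ≤ sum (map g L)
    sum-mono [] f g le = ℕ.z≤n
    sum-mono (X ∷ L) f g (p ∷ le) = ℕ.+-mono-≤ p (sum-mono L f g le)

    sum-mono-< : (L : List B) (f g : B → ℕ) → (∀ X → f X ≤ g X) → Any (λ X → f X < g X) L →
                 sum (map f L) < sum (map g L)
    sum-mono-< (X ∷ L) f g le (here p) = ℕ.+-mono-<-≤ p (sum-mono L f g (All.tabulate (λ {Y} _ → le Y)))
    sum-mono-< (X ∷ L) f g le (there a) = ℕ.+-mono-≤-< (le X) (sum-mono-< L f g le a)

  module _ {A B : Set} where
    covering : (L : List B) (Q : B → A → Set) (Q? : ∀ X → Decidable (Q X)) (xs : List A) →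
               All (λ x → Any (λ X → Q X x) L) xs → length xs ≤ sum (map (λ X → length (filter (Q? X) xs)) L)
    covering L Q Q? [] covered = ℕ.z≤n
    covering L Q Q? (x ∷ xs) (x-covered ∷ covered) = ℕ.≤-trans (ℕ.s≤s (covering L Q Q? xs covered))
        (sum-mono-< L (λ X → length (filter (Q? X) xs)) (λ X → length (filter (Q? X) (x ∷ xs)))
                    grows (Any.map counted x-covered))
      where
      grows : ∀ X → length (filter (Q? X) xs) ≤ length (filter (Q? X) (x ∷ xs))
      grows X with does (Q? X x)
      ... | true = ℕ.n≤1+n _
      ... | false = ℕ.≤-refl
      counted : ∀ {X} → Q X x → length (filter (Q? X) xs) < length (filter (Q? X) (x ∷ xs))
      counted {X} q with Q? X x
      ... | yes _ = ℕ.≤-refl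
      ... | no ¬q = ⊥-elim (¬q q)

  module _ {n : ℕ} (F : List (Subset n)) where

    Blocked : List (Subset n) → Subset n → Set
    Blocked L T = Any (λ X → T ∪ X ∈ F) L

    Blocked? : ∀ L → Decidable (Blocked L)
    Blocked? L T = any? (λ X → (T ∪ X) ∈ˢ? F) L

    blocked-through : ∀ {V X} t → Disjoint X V →
      length (filter (λ T → (T ∪ X) ∈ˢ? F) (layer V t)) ≤ degree F X
    blocked-through {V} {X} t d =
      pigeonhole (_∪ X) blocked (filter (λ e → X ⊆? e) F)
        (Unique.filter⁺ _ (Unique.filter⁺ _ (allSubsets-unique n)))
        (λ a b → ∪-injective (in-V a) (in-V b) d)
        (λ {T} a → ∈-filter⁺ (λ e → X ⊆? e) (proj₂ (∈-filter⁻ (λ T → (T ∪ X) ∈ˢ? F) {xs = layer V t} a)) (q⊆p∪q T X))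
      where
      blocked = filter (λ T → (T ∪ X) ∈ˢ? F) (layer V t)
      in-V : ∀ {T} → T ∈ blocked → T ⊑ V
      in-V a = proj₁ (proj₂ (∈-filter⁻ (InLayer? V t) {xs = allSubsets n}
                             (proj₁ (∈-filter⁻ (λ T → (T ∪ X) ∈ˢ? F) {xs = layer V t} a))))

    unblocked-exists : ∀ V t (L : List (Subset n)) → All (λ X → Disjoint X V) L →
      sum (map (degree F) L) < ∣ V ∣ C t →
      Σ[ T ∈ Subset n ] T ⊑ V × ∣ T ∣ ≡ t × ¬ Blocked L T
    unblocked-exists V t L disjoint few with any? (λ T → ¬? (Blocked? L T)) (layer V t)
    ... | yes some with find some
    ...   | T , T∈layer , free with ∈-filter⁻ (InLayer? V t) {xs = allSubsets n} T∈layer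
    ...     | _ , T⊑V , ∣T∣ = T , T⊑V , ∣T∣ , free
    unblocked-exists V t L disjoint few | no none =
      ⊥-elim (ℕ.<-irrefl refl (ℕ.≤-<-trans too-many (subst (sum (map (degree F) L) <_) (sym (length-layer V t)) few)))
      where
      all-blocked : All (Blocked L) (layer V t)
      all-blocked = All.tabulate (λ {T} T∈layer → decidable-stable (Blocked? L T) (λ free → none (lose T∈layer free)))
      too-many : length (layer V t) ≤ sum (map (degree F) L)
      too-many = ℕ.≤-trans (covering L (λ X T → T ∪ X ∈ F) (λ X T → (T ∪ X) ∈ˢ? F) (layer V t) all-blocked)
                           (sum-mono L (λ X → length (filter (λ T → (T ∪ X) ∈ˢ? F) (layer V t))) (degree F) (All.map (λ d → blocked-through t d) disjoint))


-- Starting from |V| = 2s₀ + m and L = [∅],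
-- each level removes two points u, v from V and replaces every X ∈ L by
-- X ∪ {u} and X ∪ {v}; after s₀ levels |V| = m, L consists of 2^s₀ sets of
-- size s₀ disjoint from V, and the counting bound yields the good edge.
module Construction where
  open import Defs using (degree)
  open Subsets
  open Vanishing using (Certificate; Bad₂; certificate-mono)
  open Blocking
  open import Data.Nat as ℕ using (ℕ; zero; suc; _≤_; _<_; _^_; _*_; _+_)
  import Data.Nat.Properties as ℕ
  open import Data.Nat.Combinatorics using (_C_)
  open import Data.Nat.ListAction using (sum)
  open import Data.Nat.Solver using (module +-*-Solver)
  open +-*-Solver
  open import Data.Bool using (true; false; _∨_)
  open import Data.Fin using (Fin; zero; suc)
  open import Data.Vec using (_∷_)
  open import Data.Fin.Subset using (Subset; ∣_∣; _∈_; _∉_; _∪_; ∁)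
  open import Data.Fin.Subset.Properties using (x∉p⇒x∈∁p; x∈∁p⇒x∉p)
  open import Data.List using (List; _++_; map; length)
  open import Data.List.Properties using (length-++; length-map)
  import Data.List.Membership.Propositional as List
  import Data.List.Relation.Unary.Any as Any
  import Data.List.Relation.Unary.Any.Properties as Any
  open import Data.List.Relation.Unary.All as All using (All)
  import Data.List.Relation.Unary.All.Properties as All
  open import Data.Sum using (inj₁; inj₂)
  open import Data.Product using (_×_; _,_; proj₁; proj₂)
  open import Relation.Binary.PropositionalEquality

  ∁-⊑ : ∀ {n} {W V : Subset n} → W ⊑ V → ∁ V ⊑ ∁ W
  ∁-⊑ []⊑ = []⊑
  ∁-⊑ {V = false ∷ V} (out⊑ s) = in⊑ (∁-⊑ s)
  ∁-⊑ {V = true ∷ V} (out⊑ s) = out⊑ (∁-⊑ s)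
  ∁-⊑ (in⊑ s) = out⊑ (∁-⊑ s)

  disjoint-∉ : ∀ {n} {X V : Subset n} {u} → Disjoint X V → u ∈ V → u ∉ X
  disjoint-∉ d u∈V u∈X = x∈∁p⇒x∉p (∈-⊑ u∈X d) u∈V

  disjoint-insert : ∀ {n} {X V W : Subset n} {u} → Disjoint X V → W ⊑ V → u ∉ W → Disjoint (insert X u) W
  disjoint-insert d W⊑V u∉W = insert-⊑ (x∉p⇒x∈∁p u∉W) (⊑-trans d (∁-⊑ W⊑V))

  ∪-insert : ∀ {n} (T X : Subset n) u → T ∪ insert X u ≡ insert T u ∪ X
  ∪-insert (true ∷ T) (b ∷ X) zero = refl
  ∪-insert (false ∷ T) (b ∷ X) zero = refl
  ∪-insert (a ∷ T) (b ∷ X) (suc u) = cong ((a ∨ b) ∷_) (∪-insert T X u)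

  SparseDegrees : ∀ {n} → List (Subset n) → ℕ → ℕ → ℕ → Set
  SparseDegrees F s₀ m t = ∀ L → length L ≡ 2 ^ s₀ → All (λ X → ∣ X ∣ ≡ s₀) L → sum (map (degree F) L) < m C t

  module _ {n : ℕ} (F : List (Subset n)) (s₀ m t : ℕ) (sparse : SparseDegrees F s₀ m t) where

    Admissible : ℕ → Subset n → List (Subset n) → Set
    Admissible s V L = All (λ X → Disjoint X V × ∣ X ∣ + s ≡ s₀) L × length L * 2 ^ s ≡ 2 ^ s₀

    module Step {s V L u v} (u∈V : u ∈ V) (v∈V : v ∈ V) (u≢v : u ≢ v)
                (admissible : Admissible (suc s) V L) where
      V′ : Subset n
      V′ = remove (remove V u) v
      L′ : List (Subset n)
      L′ = map (λ X → insert X u) L ++ map (λ X → insert X v) L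

      V′⊑V : V′ ⊑ V
      V′⊑V = ⊑-trans (remove-⊑ (remove V u) v) (remove-⊑ V u)

      ∣V′∣ : suc (suc ∣ V′ ∣) ≡ ∣ V ∣
      ∣V′∣ = trans (cong suc (∣remove∣ (remove V u) (∈-remove u v∈V (λ e → u≢v (sym e))))) (∣remove∣ V u∈V)

      admissible′ : Admissible s V′ L′
      admissible′ = All.++⁺ (All.map⁺ (All.map (grow u u∈V u∉V′) (proj₁ admissible)))
                            (All.map⁺ (All.map (grow v v∈V (∉-remove (remove V u) v)) (proj₁ admissible))) ,
                    trans (cong (_* 2 ^ s) (trans (length-++ (map (λ X → insert X u) L))
                                                  (cong₂ _+_ (length-map _ L) (length-map _ L))))
                          (trans (double (length L) (2 ^ s)) (proj₂ admissible))
        where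
        u∉V′ : u ∉ V′
        u∉V′ m = ∉-remove V u (∈-⊑ m (remove-⊑ (remove V u) v))
        grow : ∀ w → w ∈ V → w ∉ V′ → ∀ {X} → Disjoint X V × ∣ X ∣ + suc s ≡ s₀ →
               Disjoint (insert X w) V′ × ∣ insert X w ∣ + s ≡ s₀
        grow w w∈V w∉V′ {X} (d , ∣X∣) = disjoint-insert d V′⊑V w∉V′ ,
          trans (cong (_+ s) (∣insert∣ X (disjoint-∉ d w∈V))) (trans (sym (ℕ.+-suc ∣ X ∣ s)) ∣X∣)
        double : ∀ a b → (a + a) * b ≡ a * (b + (b + 0))
        double = solve 2 (λ a b → (a :+ a) :* b := a :* (b :+ (b :+ con 0))) refl

      blocked′ : ∀ T → Bad₂ (Blocked F L) u v T → Blocked F L′ T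
      blocked′ T (inj₁ b) = Any.++⁺ˡ (Any.map⁺ (Any.map (λ {X} x → subst (List._∈ F) (sym (∪-insert T X u)) x) b))
      blocked′ T (inj₂ b) = Any.++⁺ʳ (map (λ X → insert X u) L)
                              (Any.map⁺ (Any.map (λ {X} x → subst (List._∈ F) (sym (∪-insert T X v)) x) b))

    certificate-exists : ∀ s V L → ∣ V ∣ ≡ s + s + m → Admissible s V L → Certificate s (s + t) V (Blocked F L)
    certificate-exists zero V L ∣V∣ (disjoint , ∣L∣) =
      unblocked-exists F V t L (All.map proj₁ disjoint)
        (subst (λ z → sum (map (degree F) L) < z C t) (sym ∣V∣)
          (sparse L (trans (sym (ℕ.*-identityʳ (length L))) ∣L∣)
            (All.map (λ {X} p → trans (sym (ℕ.+-identityʳ ∣ X ∣)) (proj₂ p)) disjoint)))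
    certificate-exists (suc s) V L ∣V∣ admissible =
      two-elements V (subst (2 ≤_) (sym (trans ∣V∣ sizes)) (ℕ.s≤s (ℕ.s≤s ℕ.z≤n))) ,
      λ u v u∈V v∈V u≢v → let open Step u∈V v∈V u≢v admissible in
        certificate-mono s (s + t) V′ (Blocked F L′) (Bad₂ (Blocked F L) u v) blocked′
          (certificate-exists s V′ L′ (ℕ.suc-injective (ℕ.suc-injective (trans ∣V′∣ (trans ∣V∣ sizes)))) admissible′)
      where
      sizes : suc s + suc s + m ≡ suc (suc (s + s + m))
      sizes = solve 2 (λ s m → con 1 :+ s :+ (con 1 :+ s) :+ m := con 1 :+ (con 1 :+ (s :+ s :+ m))) refl s m


module Rank where
  open import Defs using (ColumnsIndependent; HasRank)
  open Enumeration using (pigeonhole)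
  open import Data.List using (List; length)
  open import Data.List.Relation.Unary.All using (tabulate; lookup)
  open import Data.List.Relation.Unary.Unique.Propositional using (Unique)
  open import Data.Product using (_,_)
  open import Data.Rational using (ℚ)
  open import Function using (id)
  open import Relation.Binary.PropositionalEquality using (refl)

  full-rank : ∀ {R C : Set} (rows : List R) (cols : List C) (M : R → C → ℚ) →
    Unique cols → ColumnsIndependent rows cols M → HasRank rows cols M (length cols)
  full-rank rows cols M unique independent =
    (cols , unique , tabulate id , refl , independent) ,
    λ sub unique′ sub⊆cols _ → pigeonhole id sub cols unique′ (λ _ _ e → e) (lookup sub⊆cols)


module Independence where
  open import Defs
  open Subsets using (⊑-⊤; ⊥-⊑)
  open Vanishing using (Certificate; EdgeEquations; certificate-mono; vanishing)
  open RowSums using (row-sum)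
  open Enumeration using (∈-allSubsets)
  open Blocking using (Blocked)
  open Construction using (SparseDegrees; certificate-exists)
  open import Data.Nat using (_+_)
  open import Data.Nat.Properties using (_≟_; +-identityʳ)
  open import Data.Fin.Subset using (Subset; ∣_∣; ⊥; ⊤)
  open import Data.Fin.Subset.Properties using (∣⊤∣≡n; ∣⊥∣≡0; ∪-identityʳ)
  open import Data.List using (List; []; _∷_)
  open import Data.List.Membership.Propositional using (_∈_)
  open import Data.List.Membership.Propositional.Properties using (∈-filter⁺; ∈-filter⁻)
  open import Data.List.Relation.Unary.Any using (here)
  open import Data.List.Relation.Unary.All using ([]; _∷_)
  open import Data.Product using (_,_; proj₂)
  open import Relation.Nullary using (¬?)
  open import Relation.Binary.PropositionalEquality

  columns-independent : ∀ n s m t (F : List (Subset n)) → n ≡ s + s + m → SparseDegrees F s m t →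
    ColumnsIndependent (edgesMinus n (s + t) F) (kSets n s) inclEntry
  columns-independent n s m t F n≡ sparse c equations S S∈kSets =
    vanishing s (s + t) ⊤ (_∈ F) certificate c edge-equations S (⊑-⊤ S)
      (proj₂ (∈-filter⁻ (λ p → ∣ p ∣ ≟ s) {xs = allSubsets n} S∈kSets))
    where
    certificate : Certificate s (s + t) ⊤ (_∈ F)
    certificate = certificate-mono s (s + t) ⊤ (Blocked F (⊥ ∷ [])) (_∈ F)
      (λ T T∈F → here (subst (_∈ F) (sym (∪-identityʳ T)) T∈F))
      (certificate-exists F s m t sparse s ⊤ (⊥ ∷ []) (trans (∣⊤∣≡n n) n≡)
        (((⊥-⊑ _ , cong (_+ s) (∣⊥∣≡0 n)) ∷ []) , +-identityʳ _))
    edge-equations : EdgeEquations s (s + t) ⊤ (_∈ F) c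
    edge-equations e _ ∣e∣ e∉F = trans (sym (row-sum e s c))
      (equations e (∈-filter⁺ (λ e → ¬? (e ∈ˢ? F))
                     (∈-filter⁺ (λ p → ∣ p ∣ ≟ (s + t)) (∈-allSubsets e) ∣e∣) e∉F))


-- From the degree hypothesis to the degree sums used by Construction: a list
-- of 2^s sets of size s has total degree below 2^s·C(n-s, r-s)/(4^s+1)
-- ≤ 4^s·C(n-2s, r-s)/(4^s+1) < C(n-2s, r-s).
module DegreeSums where
  open import Defs using (degree)
  open Binomials using (C-+-≤)
  open Construction using (SparseDegrees)
  open import Data.Nat as ℕ using (ℕ; suc; _≤_; _<_; _^_; _*_; _+_; _∸_)
  import Data.Nat.Properties as ℕ
  open import Data.Nat.Combinatorics using (_C_)
  open import Data.Nat.ListAction using (sum)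
  open import Data.Nat.Solver using (module +-*-Solver)
  open +-*-Solver
  open import Data.Fin.Subset using (Subset; ∣_∣)
  open import Data.List using (List; []; _∷_; map; length)
  open import Data.List.Relation.Unary.All as All using (All; []; _∷_)
  open import Data.Empty using (⊥-elim)
  open import Relation.Binary.PropositionalEquality

  module _ {B : Set} where
    sum-* : ∀ (L : List B) f k → sum (map (λ X → k * f X) L) ≡ k * sum (map f L)
    sum-* [] f k = sym (ℕ.*-zeroʳ k)
    sum-* (X ∷ L) f k = trans (cong (k * f X +_) (sum-* L f k)) (sym (ℕ.*-distribˡ-+ k (f X) _))

    sum-≤ : ∀ (L : List B) f K → All (λ X → f X ≤ K) L → sum (map f L) ≤ length L * K
    sum-≤ [] f K all = ℕ.z≤n
    sum-≤ (X ∷ L) f K (p ∷ all) = ℕ.+-mono-≤ p (sum-≤ L f K all)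

    sum-< : ∀ X (L : List B) f K → All (λ X → f X < K) (X ∷ L) → sum (map f (X ∷ L)) < length (X ∷ L) * K
    sum-< X L f K (p ∷ all) = ℕ.+-mono-<-≤ p (sum-≤ L f K (All.map ℕ.<⇒≤ all))

  sparse-degrees : ∀ {n} (F : List (Subset n)) s m t → 2 * t ≤ m →
    (∀ S → ∣ S ∣ ≡ s → suc (2 ^ s * 2 ^ s) * degree F S < (s + m) C t) → SparseDegrees F s m t
  sparse-degrees F s m t 2t≤m low [] ∣L∣ sizes = ⊥-elim (ℕ.<-irrefl ∣L∣ (ℕ.m^n>0 2 s))
  sparse-degrees F s m t 2t≤m low (X ∷ L) ∣L∣ sizes =
    ℕ.*-cancelˡ-< (suc K) _ _ (begin-strict
      suc K * sum (map (degree F) (X ∷ L))              ≡⟨ sym (sum-* (X ∷ L) (degree F) (suc K)) ⟩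
      sum (map (λ X → suc K * degree F X) (X ∷ L))      <⟨ sum-< X L _ _ (All.map (low _) sizes) ⟩
      length (X ∷ L) * ((s + m) C t)                    ≡⟨ cong (_* ((s + m) C t)) ∣L∣ ⟩
      2 ^ s * ((s + m) C t)                             ≤⟨ ℕ.*-monoʳ-≤ (2 ^ s) (C-+-≤ s m t 2t≤m) ⟩
      2 ^ s * (2 ^ s * (m C t))                         ≡⟨ sym (ℕ.*-assoc (2 ^ s) (2 ^ s) (m C t)) ⟩
      K * (m C t)                                       ≤⟨ ℕ.*-monoˡ-≤ (m C t) (ℕ.n≤1+n K) ⟩
      suc K * (m C t)                                   ∎)
    where
    open ℕ.≤-Reasoning
    K = 2 ^ s * 2 ^ s

  room : ∀ {n r s} → s ≤ r → r + r ≤ n → 2 * (r ∸ s) ≤ n ∸ (s + s)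
  room {n} {r} {s} s≤r 2r≤n = ℕ.m+n≤o⇒m≤o∸n (2 * (r ∸ s)) (subst (_≤ n) 2r≡ 2r≤n)
    where
    2r≡ : r + r ≡ 2 * (r ∸ s) + (s + s)
    2r≡ = trans (cong₂ _+_ (sym (ℕ.m+[n∸m]≡n s≤r)) (sym (ℕ.m+[n∸m]≡n s≤r)))
                (solve 2 (λ s t → (s :+ t) :+ (s :+ t) := con 2 :* t :+ (s :+ s)) refl s (r ∸ s))

  n∸s≡s+m : ∀ {n} s → s + s ≤ n → n ∸ s ≡ s + (n ∸ (s + s))
  n∸s≡s+m {n} s 2s≤n = begin-equality
    n ∸ s                        ≡⟨ cong (_∸ s) (sym (ℕ.m+[n∸m]≡n 2s≤n)) ⟩
    s + s + (n ∸ (s + s)) ∸ s    ≡⟨ cong (_∸ s) (ℕ.+-assoc s s _) ⟩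
    s + (s + (n ∸ (s + s))) ∸ s  ≡⟨ ℕ.m+n∸m≡n s _ ⟩
    s + (n ∸ (s + s))            ∎
    where open ℕ.≤-Reasoning

module FullRank where
  open import Defs
  open Enumeration using (length-kSets; kSets-unique)
  open Rank using (full-rank)
  open Independence using (columns-independent)
  open DegreeSums using (sparse-degrees; room; n∸s≡s+m)
  open import Data.Nat using (suc; _+_; _^_; _*_; _<_; _≤_; _∸_)
  open import Data.Nat.Properties using (≤-trans; +-mono-≤; m+[n∸m]≡n)
  open import Data.Nat.Combinatorics using (_C_)
  open import Data.Fin.Subset using (Subset; ∣_∣)
  open import Data.List using (List)
  open import Relation.Binary.PropositionalEquality using (_≡_; subst; sym)

  rank-under-degree-bound : ∀ n r s (F : List (Subset n)) → s ≤ r → r + r ≤ n →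
    (∀ S → ∣ S ∣ ≡ s → suc (2 ^ s * 2 ^ s) * degree F S < (n ∸ s) C (r ∸ s)) →
    RankInclusionMinus n r s F (n C s)
  rank-under-degree-bound n r s F s≤r 2r≤n low =
    subst (HasRank (edgesMinus n r F) (kSets n s) inclEntry) (length-kSets n s)
      (full-rank _ _ inclEntry (kSets-unique n s) independent)
    where
    2s≤n : s + s ≤ n
    2s≤n = ≤-trans (+-mono-≤ s≤r s≤r) 2r≤n
    t = r ∸ s
    m = n ∸ (s + s)
    low′ : ∀ S → ∣ S ∣ ≡ s → suc (2 ^ s * 2 ^ s) * degree F S < (s + m) C t
    low′ S ∣S∣ = subst (λ x → suc (2 ^ s * 2 ^ s) * degree F S < x C t) (n∸s≡s+m s 2s≤n) (low S ∣S∣)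
    independent : ColumnsIndependent (edgesMinus n r F) (kSets n s) inclEntry
    independent = subst (λ r → ColumnsIndependent (edgesMinus n r F) (kSets n s) inclEntry) (m+[n∸m]≡n s≤r)
      (columns-independent n s m t F (sym (m+[n∸m]≡n 2s≤n)) (sparse-degrees F s m t (room s≤r 2r≤n) low′))


open NaturalRationals using (1/suc; 1/suc-positive; below-fraction)
open Enumeration using (∈-kSets)
open FullRank using (rank-under-degree-bound)
open import Defs
open import Data.Nat using (ℕ; suc; _+_; _^_; _*_; _≤_; _∸_; s≤s; z≤n)
open import Data.Nat.Properties using (≤-trans; n≤1+n)
open import Data.Nat.Combinatorics using (_C_)
open import Data.Fin.Subset using (Subset; ∣_∣)
open import Data.List using (List; length)
open import Data.List.Relation.Unary.All using (All)
open import Data.List.Relation.Unary.Unique.Propositional using (Unique)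
open import Data.List.Membership.Propositional using (_∈_)
open import Data.Rational using (ℚ; 0ℚ; 1ℚ) renaming (_≤_ to _≤ℚ_; _<_ to _<ℚ_; _*_ to _*ℚ_)
open import Data.Rational.Properties using (positive⁻¹)
open import Data.Product using (Σ; _×_; _,_)
open import Relation.Binary.PropositionalEquality using (_≡_)

-- ε = 1, α = 1/(4^s + 1), n₁ = 2r + 1; only the degree condition is used.
theorem6 : (r s : ℕ) → s ≤ r →
    Σ ℚ λ ε → Σ ℚ λ α → Σ ℕ λ n₁ →
    (0ℚ <ℚ ε) × (0ℚ <ℚ α) × (1 ≤ n₁) ×
    ((n : ℕ) → n₁ ≤ n →
    (F : List (Subset n)) → Unique F → All (λ e → ∣ e ∣ ≡ r) F →
    ℕtoℚ (length F) ≤ℚ ε *ℚ ℕtoℚ n *ℚ ℕtoℚ ((n ∸ s) C (r ∸ s)) →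
    (∀ S → S ∈ kSets n s → ℕtoℚ (degree F S) <ℚ α *ℚ ℕtoℚ ((n ∸ s) C (r ∸ s))) →
    RankInclusionMinus n r s F (n C s))
theorem6 r s s≤r =
  1ℚ , 1/suc K , suc (r + r) , positive⁻¹ 1ℚ , 1/suc-positive K , s≤s z≤n ,
  λ n n₁≤n F _ _ _ low →
    rank-under-degree-bound n r s F s≤r (≤-trans (n≤1+n _) n₁≤n)
      (λ S ∣S∣ → below-fraction K (degree F S) _ (low S (∈-kSets ∣S∣)))
  where
  K = 2 ^ s * 2 ^ s
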